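{- Right reductions are terminating on connected diagrams: there is no infinite sequence $D_0\to_R D_1\to_R D_2\to_R\cdots$ of right exchanges starting from a valid connected diagram $D_0$.
   Context: A diagram is a tuple $D=(S,N,H,I,O)$ with $S,N\in\mathbb N$ and $H,I,O:\{0,\dots,N-1\}\to\mathbb N$; $\Delta(n)=O(n)-I(n)$, $W(0)=S$, $W(n+1)=W(n)+\Delta(n)$; $D$ is valid if $W(n)\ge H(n)+I(n)$ for all $n<N$. Geometrically, the vertex at height $n$ (heights numbered top to bottom) has as inputs the wires $H(n),\dots,H(n)+I(n)-1$ among the $W(n)$ wires crossing level $n$ (numbered left to right) and as outputs the wires $H(n),\dots,H(n)+O(n)-1$ of level $n+1$; wire $k<H(n)$ of level $n$ continues as wire $k$ of level $n+1$ and wire $k\ge H(n)+I(n)$ continues as wire $k+\Delta(n)$. Edges are the resulting maximal wire chains; each joins two vertices, or a vertex and the top/bottom boundary, or the two boundaries. $D$ is connected if the multigraph whose vertices are the vertices of $D$ and whose edges are the edges of $D$ joining two vertices is connected. For $0\le n\le N-2$, a right exchange at height $n$ is admissible when $H(n+1)\ge H(n)+O(n)$ and yields $D'$ identical to $D$ except $H'(n)=H(n+1)-\Delta(n)$, $I'(n)=I(n+1)$, $O'(n)=O(n+1)$, $H'(n+1)=H(n)$, $I'(n+1)=I(n)$, $O'(n+1)=O(n)$; we write $D\to_R D'$. -}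

module Defs where

open import Data.Nat using (ℕ; zero; suc; _+_; _∸_; _≤_; _<_; _<?_)
open import Data.Fin using (Fin; toℕ; fromℕ<)
open import Data.Product using (Σ; _×_; _,_; ∃)
open import Relation.Nullary using (¬_; yes; no)
open import Relation.Binary.PropositionalEquality using (_≡_; _≢_)
open import Relation.Binary.Construct.Closure.ReflexiveTransitive using (Star)
open import Relation.Binary.Construct.Closure.Symmetric using (SymClosure)

-- A diagram with S top wires and N vertices (heights 0..N-1).
record Diagram (S N : ℕ) : Set where
  field
    H I O : Fin N → ℕ
open Diagram public

at : {N : ℕ} → (Fin N → ℕ) → ℕ → ℕ
at {N} f n with n <? N
... | yes p = f (fromℕ< p)
... | no _  = 0

-- W(0) = S, W(n+1) = W(n) + O(n) - I(n).  Truncated subtraction is exact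
-- whenever W(n) ≥ I(n), which validity guarantees at every height.
W : {S N : ℕ} → Diagram S N → ℕ → ℕ
W {S} D zero    = S
W {S} D (suc n) = (W D n ∸ at (I D) n) + at (O D) n

Valid : {S N : ℕ} → Diagram S N → Set
Valid {N = N} D = (n : Fin N) → H D n + I D n ≤ W D (toℕ n)

-- One step of a wire downward: wire k at level n (not an input of vertex n)
-- continues to level n+1.  Positions are pairs (level , wire index).
data WireStep {S N : ℕ} (D : Diagram S N) : ℕ × ℕ → ℕ × ℕ → Set where
  pass-left  : (n : Fin N) (k : ℕ) → k < H D n →
               WireStep D (toℕ n , k) (suc (toℕ n) , k)
  pass-right : (n : Fin N) (k : ℕ) → H D n + I D n ≤ k →
               WireStep D (toℕ n , k) (suc (toℕ n) , (k ∸ I D n) + O D n)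

-- An edge joining vertices a and b: a wire chain starting at an output of a
-- (level a+1) and ending at an input of b (level b).
EdgeBetween : {S N : ℕ} → Diagram S N → Fin N → Fin N → Set
EdgeBetween D a b =
  Σ ℕ λ j → Σ ℕ λ k →
    (H D a ≤ j) × (j < H D a + O D a) ×
    Star (WireStep D) (suc (toℕ a) , j) (toℕ b , k) ×
    (H D b ≤ k) × (k < H D b + I D b)

Connected : {S N : ℕ} → Diagram S N → Set
Connected {N = N} D = (u v : Fin N) → Star (SymClosure (EdgeBetween D)) u v

RightExchangeAt : {S N : ℕ} → Diagram S N → Diagram S N → Fin N → Fin N → Set
RightExchangeAt {N = N} D D' n m =
  (toℕ m ≡ suc (toℕ n)) ×
  (H D n + O D n ≤ H D m) ×                      -- admissibility
  (H D' n ≡ (H D m ∸ O D n) + I D n) ×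
  (I D' n ≡ I D m) × (O D' n ≡ O D m) ×
  (H D' m ≡ H D n) × (I D' m ≡ I D n) × (O D' m ≡ O D n) ×
  ((j : Fin N) → j ≢ n → j ≢ m →
     (H D' j ≡ H D j) × (I D' j ≡ I D j) × (O D' j ≡ O D j))

_→R_ : {S N : ℕ} → Diagram S N → Diagram S N → Set
_→R_ {N = N} D D' = Σ (Fin N) λ n → Σ (Fin N) λ m → RightExchangeAt D D' n m

-- Suppose D₀ →R D₁ →R ⋯ were infinite.  Exchanges permute adjacent heights,
-- so each vertex keeps its identity (`height k v`), and each vertex-vertex
-- edge of D₀ persists: the invariant `EdgeInv` of its wire chain is
-- transported by every exchange, so exchanged vertices are never adjacent.
-- Relative to an edge f a vertex lies in one of four quarters (above the
-- source, left of the wire, below the target, right of it) and advances by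
-- one quarter, mod 4, whenever it is exchanged with an endpoint of f.  A
-- potential shows that the endpoints of any edge g turn around f almost
-- equally often; the source of f never turns around f, so by connectivity
-- all turn counts are bounded.  Yet each exchange of A with B turns A around
-- the first edge of a fixed path from B to A, so a bounded sum over all pairs
-- grows at every step.
module Submission where

open import Defs
open import Data.Nat using (ℕ; zero; suc; _+_; _*_; _∸_; _≤_; _<_; z≤n; s≤s; _<ᵇ_; _≤ᵇ_; _≡ᵇ_; _≟_; _<?_)
open import Data.Nat.Properties
open import Data.Nat.Tactic.RingSolver using (solve-∀)
open import Algebra.Properties.CommutativeSemigroup +-commutativeSemigroup using (xy∙z≈xz∙y)
open import Data.Bool using (Bool; true; false; if_then_else_; T; _∧_; _∨_; not)
open import Data.Bool.Properties using (∧-zeroʳ)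
open import Data.Unit using (tt)
open import Data.Empty using (⊥; ⊥-elim)
open import Data.Product using (Σ; _×_; _,_; proj₁; proj₂)
open import Data.Sum using (_⊎_; inj₁; inj₂)
open import Data.Fin using (Fin; toℕ; fromℕ<)
import Data.Fin as F
import Data.Fin.Properties as FP
open import Relation.Nullary using (¬_; Dec; yes; no)
open import Relation.Nullary.Decidable using (_×-dec_)
open import Relation.Binary using (tri<; tri≈; tri>)
open import Relation.Binary.PropositionalEquality
open import Relation.Binary.Construct.Closure.ReflexiveTransitive using (Star; ε; _◅_)
open import Relation.Binary.Construct.Closure.Symmetric using (SymClosure; fwd; bwd)

T⇒true : ∀ {b} → T b → b ≡ true
T⇒true {true} _ = refl

¬T⇒false : ∀ {b} → ¬ T b → b ≡ false
¬T⇒false {false} _ = refl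
¬T⇒false {true} h = ⊥-elim (h tt)

<ᵇ-true : ∀ {m n} → m < n → (m <ᵇ n) ≡ true
<ᵇ-true p = T⇒true (<⇒<ᵇ p)

<ᵇ-false : ∀ {m n} → n ≤ m → (m <ᵇ n) ≡ false
<ᵇ-false {m} {n} p = ¬T⇒false (λ t → <⇒≱ (<ᵇ⇒< m n t) p)

≤ᵇ-true : ∀ {m n} → m ≤ n → (m ≤ᵇ n) ≡ true
≤ᵇ-true p = T⇒true (≤⇒≤ᵇ p)

≤ᵇ-false : ∀ {m n} → n < m → (m ≤ᵇ n) ≡ false
≤ᵇ-false {m} {n} p = ¬T⇒false (λ t → <⇒≱ p (≤ᵇ⇒≤ m n t))

≡ᵇ-true : ∀ {m n} → m ≡ n → (m ≡ᵇ n) ≡ true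
≡ᵇ-true {m} {n} p = T⇒true (≡⇒≡ᵇ m n p)

≡ᵇ-false : ∀ {m n} → m ≢ n → (m ≡ᵇ n) ≡ false
≡ᵇ-false {m} {n} p = ¬T⇒false (λ t → p (≡ᵇ⇒≡ m n t))

-- The transposition of the adjacent heights n and n+1.  An exchange at
-- height n moves the vertex at height x to height `swap n x`.

swap : ℕ → ℕ → ℕ
swap n x = if x ≡ᵇ n then suc n else (if x ≡ᵇ suc n then n else x)

swap-n : ∀ n → swap n n ≡ suc n
swap-n n rewrite ≡ᵇ-true {n} {n} refl = refl

swap-suc : ∀ n → swap n (suc n) ≡ n
swap-suc n rewrite ≡ᵇ-false {suc n} {n} 1+n≢n | ≡ᵇ-true {suc n} {suc n} refl = refl

swap-other : ∀ n x → x ≢ n → x ≢ suc n → swap n x ≡ x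
swap-other n x p q rewrite ≡ᵇ-false p | ≡ᵇ-false q = refl

data SwapCase (n x : ℕ) : Set where
  at-n      : x ≡ n → SwapCase n x
  at-suc    : x ≡ suc n → SwapCase n x
  elsewhere : x ≢ n → x ≢ suc n → SwapCase n x

swapCase : ∀ n x → SwapCase n x
swapCase n x with x ≟ n
... | yes p = at-n p
... | no p with x ≟ suc n
... | yes q = at-suc q
... | no q = elsewhere p q

swap-involutive : ∀ n x → swap n (swap n x) ≡ x
swap-involutive n x with swapCase n x
... | at-n refl rewrite swap-n n = swap-suc n
... | at-suc refl rewrite swap-suc n = swap-n n
... | elsewhere p q rewrite swap-other n x p q = swap-other n x p q

swap-injective : ∀ n {x y} → swap n x ≡ swap n y → x ≡ y
swap-injective n {x} {y} e = trans (sym (swap-involutive n x)) (trans (cong (swap n) e) (swap-involutive n y))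

swap-< : ∀ n {x y} → x < y → ¬ (x ≡ n × y ≡ suc n) → swap n x < swap n y
swap-< n {x} {y} lt na with swapCase n x | swapCase n y
... | at-n refl | at-n refl = ⊥-elim (<-irrefl refl lt)
... | at-n refl | at-suc refl = ⊥-elim (na (refl , refl))
... | at-n refl | elsewhere p q rewrite swap-n n | swap-other n y p q = ≤∧≢⇒< lt (λ e → q (sym e))
... | at-suc refl | at-n refl = ⊥-elim (<-asym lt (n<1+n n))
... | at-suc refl | at-suc refl = ⊥-elim (<-irrefl refl lt)
... | at-suc refl | elsewhere p q rewrite swap-suc n | swap-other n y p q = <-trans (n<1+n n) lt
... | elsewhere p q | at-n refl rewrite swap-n n | swap-other n x p q = <-trans lt (n<1+n n)
... | elsewhere p q | at-suc refl rewrite swap-suc n | swap-other n x p q = ≤∧≢⇒< (≤-pred lt) p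
... | elsewhere p q | elsewhere p' q' rewrite swap-other n x p q | swap-other n y p' q' = lt

NotSwapped : ℕ → ℕ → ℕ → Set
NotSwapped n x y = ¬ (x ≡ n × y ≡ suc n) × ¬ (x ≡ suc n × y ≡ n)

NotSwapped-sym : ∀ {n x y} → NotSwapped n x y → NotSwapped n y x
NotSwapped-sym (h1 , h2) = (λ { (p , q) → h2 (q , p) }) , (λ { (p , q) → h1 (q , p) })

NotSwapped-left : ∀ {n x y} → x ≢ n → x ≢ suc n → NotSwapped n x y
NotSwapped-left p q = (λ { (x , _) → p x }) , (λ { (x , _) → q x })

NotSwapped-right : ∀ {n x y} → y ≢ n → y ≢ suc n → NotSwapped n x y
NotSwapped-right p q = (λ { (_ , y) → q y }) , (λ { (_ , y) → p y })

NotSwapped-same : ∀ {n x y} → x ≡ y → NotSwapped n x y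
NotSwapped-same refl = (λ { (p , q) → 1+n≢n (trans (sym q) p) }) , (λ { (p , q) → 1+n≢n (trans (sym p) q) })

swap-≡ᵇ : ∀ n a b → (swap n a ≡ᵇ swap n b) ≡ (a ≡ᵇ b)
swap-≡ᵇ n a b with a ≟ b
... | yes refl = trans (≡ᵇ-true {swap n a} refl) (sym (≡ᵇ-true {a} refl))
... | no p = trans (≡ᵇ-false (λ e → p (swap-injective n e))) (sym (≡ᵇ-false p))

swap-≤ᵇ : ∀ n a b → NotSwapped n a b → (swap n a ≤ᵇ swap n b) ≡ (a ≤ᵇ b)
swap-≤ᵇ n a b (h1 , h2) with <-cmp a b
... | tri< lt _ _ = trans (≤ᵇ-true (<⇒≤ (swap-< n lt h1))) (sym (≤ᵇ-true (<⇒≤ lt)))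
... | tri≈ _ refl _ = trans (≤ᵇ-true {swap n a} ≤-refl) (sym (≤ᵇ-true {a} ≤-refl))
... | tri> _ _ gt = trans (≤ᵇ-false (swap-< n gt (λ { (x , y) → h2 (y , x) }))) (sym (≤ᵇ-false gt))

swap-<ᵇ : ∀ n a b → NotSwapped n a b → (swap n a <ᵇ swap n b) ≡ (a <ᵇ b)
swap-<ᵇ n a b (h1 , h2) with <-cmp a b
... | tri< lt _ _ = trans (<ᵇ-true (swap-< n lt h1)) (sym (<ᵇ-true lt))
... | tri≈ _ refl _ = trans (<ᵇ-false {swap n a} ≤-refl) (sym (<ᵇ-false {a} ≤-refl))
... | tri> _ _ gt = trans (<ᵇ-false (<⇒≤ (swap-< n gt (λ { (x , y) → h2 (y , x) })))) (sym (<ᵇ-false (<⇒≤ gt)))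

-- The wire at position q just above a vertex with interface (h, i, o), i.e.
-- inputs h … h+i-1 and outputs h … h+o-1, continues below it at position
-- `past h i o q`.  The formula is meaningful when the wire misses the inputs.

past : ℕ → ℕ → ℕ → ℕ → ℕ
past h i o q = if q <ᵇ h then q else q ∸ i + o

past-left : ∀ h i o {q} → q < h → past h i o q ≡ q
past-left h i o {q} lt rewrite <ᵇ-true lt = refl

past-right : ∀ h i o {q} → h ≤ q → past h i o q ≡ q ∸ i + o
past-right h i o {q} le rewrite <ᵇ-false le = refl

past-right′ : ∀ h i o {r} → h ≤ r + i → past h i o (r + i) ≡ r + o
past-right′ h i o {r} le rewrite past-right h i o le | m+n∸n≡m r i = refl

Misses : ℕ → ℕ → ℕ → Set
Misses h i q = q < h ⊎ h + i ≤ q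

right-of : ∀ {h i q} → h + i ≤ q → Σ ℕ λ r → (q ≡ r + i) × (h ≤ r)
right-of {h} {i} {q} le = q ∸ i , sym (m∸n+n≡m (≤-trans (m≤n+m i h) le)) ,
  subst (λ x → x ≤ q ∸ i) (m+n∸n≡m h i) (∸-monoˡ-≤ i le)

-- Vertex A, with interface
-- (a, iA, oA), lies above vertex B, with interface (c + oA, iB, oB), and
-- a ≤ c expresses admissibility.  After the exchange B is on top with
-- interface (c + iA, iB, oB) and A below it with interface (a, iA, oA).
-- A wire running beside A and then B runs beside B and then A afterwards,
-- ends at the same position, and stays on the same side of each vertex.
record Commutes (a c iA oA iB oB p : ℕ) : Set where
  field
    same-exit : past a iA oA (past (c + iA) iB oB p) ≡ past (c + oA) iB oB (past a iA oA p)
    misses-B  : Misses (c + iA) iB p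
    misses-A  : Misses a iA (past (c + iA) iB oB p)
    side-A    : (past (c + iA) iB oB p <ᵇ a) ≡ (p <ᵇ a)
    side-B    : (p <ᵇ c + iA) ≡ (past a iA oA p <ᵇ c + oA)

commutes-left : ∀ a c iA oA iB oB p → a ≤ c → p < a → Commutes a c iA oA iB oB p
commutes-left a c iA oA iB oB p a≤c p<a = record
  { same-exit = trans (cong (past a iA oA) e1) (trans (past-left a iA oA p<a) (sym (trans (cong (past (c + oA) iB oB) (past-left a iA oA p<a)) (past-left (c + oA) iB oB p<co))))
  ; misses-B  = inj₁ p<ci
  ; misses-A  = subst (Misses a iA) (sym e1) (inj₁ p<a)
  ; side-A    = cong (_<ᵇ a) e1
  ; side-B    = trans (<ᵇ-true p<ci) (sym (trans (cong (_<ᵇ c + oA) (past-left a iA oA p<a)) (<ᵇ-true p<co)))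
  }
  where
    p<ci = <-≤-trans p<a (≤-trans a≤c (m≤m+n c iA))
    p<co = <-≤-trans p<a (≤-trans a≤c (m≤m+n c oA))
    e1 : past (c + iA) iB oB p ≡ p
    e1 = past-left (c + iA) iB oB p<ci

commutes-middle : ∀ a c iA oA iB oB r → a ≤ r → r < c → Commutes a c iA oA iB oB (r + iA)
commutes-middle a c iA oA iB oB r a≤r r<c = record
  { same-exit = trans (cong (past a iA oA) e1) (trans e0 (sym (trans (cong (past (c + oA) iB oB) e0) (past-left (c + oA) iB oB (+-monoˡ-< oA r<c)))))
  ; misses-B  = inj₁ p<ci
  ; misses-A  = subst (Misses a iA) (sym e1) (inj₂ (+-monoˡ-≤ iA a≤r))
  ; side-A    = cong (_<ᵇ a) e1
  ; side-B    = trans (<ᵇ-true p<ci) (sym (trans (cong (_<ᵇ c + oA) e0) (<ᵇ-true (+-monoˡ-< oA r<c))))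
  }
  where
    p<ci = +-monoˡ-< iA r<c
    e0 = past-right′ a iA oA (≤-trans a≤r (m≤m+n r iA))
    e1 : past (c + iA) iB oB (r + iA) ≡ r + iA
    e1 = past-left (c + iA) iB oB p<ci

commutes-right : ∀ a c iA oA iB oB u → a ≤ c → c ≤ u → Commutes a c iA oA iB oB ((u + iB) + iA)
commutes-right a c iA oA iB oB u a≤c c≤u = record
  { same-exit = trans (cong (past a iA oA) B-first) (trans (trans (cong (past a iA oA) (xy∙z≈xz∙y u iA oB)) (past-right′ a iA oA right-of-A′))
                  (trans (xy∙z≈xz∙y u oB oA) (sym (trans (cong (past (c + oA) iB oB) A-first) B-second))))
  ; misses-B  = inj₂ (subst (c + iA + iB ≤_) (sym (xy∙z≈xz∙y u iB iA)) (+-monoˡ-≤ iB (+-monoˡ-≤ iA c≤u)))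
  ; misses-A  = subst (Misses a iA) (sym B-first) (inj₂ (≤-trans (+-monoˡ-≤ iA a≤u) (m≤m+n (u + iA) oB)))
  ; side-A    = trans (cong (_<ᵇ a) B-first) (trans (<ᵇ-false (≤-trans a≤u (≤-trans (m≤m+n u iA) (m≤m+n (u + iA) oB)))) (sym (<ᵇ-false right-of-A)))
  ; side-B    = trans (<ᵇ-false (+-monoˡ-≤ iA (≤-trans c≤u (m≤m+n u iB))))
                  (sym (trans (cong (_<ᵇ c + oA) A-first) (<ᵇ-false (≤-trans (+-monoˡ-≤ oA c≤u) (m≤m+n (u + oA) iB)))))
  }
  where
    a≤u = ≤-trans a≤c c≤u
    right-of-A : a ≤ (u + iB) + iA
    right-of-A = ≤-trans a≤u (≤-trans (m≤m+n u iB) (m≤m+n (u + iB) iA))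
    right-of-A′ : a ≤ (u + oB) + iA
    right-of-A′ = ≤-trans a≤u (≤-trans (m≤m+n u oB) (m≤m+n (u + oB) iA))
    B-first : past (c + iA) iB oB ((u + iB) + iA) ≡ (u + iA) + oB
    B-first = trans (cong (past (c + iA) iB oB) (xy∙z≈xz∙y u iB iA)) (past-right′ (c + iA) iB oB (≤-trans (+-monoˡ-≤ iA c≤u) (m≤m+n (u + iA) iB)))
    A-first : past a iA oA ((u + iB) + iA) ≡ (u + oA) + iB
    A-first = trans (past-right′ a iA oA right-of-A) (xy∙z≈xz∙y u iB oA)
    B-second : past (c + oA) iB oB ((u + oA) + iB) ≡ (u + oA) + oB
    B-second = past-right′ (c + oA) iB oB (≤-trans (+-monoˡ-≤ oA c≤u) (m≤m+n (u + oA) iB))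

exchange-commutes : ∀ a c iA oA iB oB p → a ≤ c → Misses a iA p → Misses (c + oA) iB (past a iA oA p) →
                    Commutes a c iA oA iB oB p
exchange-commutes a c iA oA iB oB p a≤c (inj₁ p<a) _ = commutes-left a c iA oA iB oB p a≤c p<a
exchange-commutes a c iA oA iB oB p a≤c (inj₂ le) misses-B with right-of {a} {iA} {p} le
... | r , refl , a≤r with subst (Misses (c + oA) iB) (past-right′ a iA oA (≤-trans a≤r (m≤m+n r iA))) misses-B
... | inj₁ lt = commutes-middle a c iA oA iB oB r a≤r (+-cancelʳ-< oA r c lt)
... | inj₂ ge with right-of {c} {iB} {r} (+-cancelʳ-≤ oA (c + iB) r (subst (_≤ r + oA) (xy∙z≈xz∙y c oA iB) ge))
... | u , refl , c≤u = commutes-right a c iA oA iB oB u a≤c c≤u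

enters-upper : ∀ a c iA iB oB p → a ≤ c → p < a + iA → (p < c + iA) × (past (c + iA) iB oB p ≡ p)
enters-upper a c iA iB oB p a≤c lt = let l = <-≤-trans lt (+-monoˡ-≤ iA a≤c) in l , past-left (c + iA) iB oB l

enters-lower : ∀ a c iA oA iB p → a ≤ c → Misses a iA p → c + oA ≤ past a iA oA p → past a iA oA p < c + oA + iB →
               (c + iA ≤ p) × (p < c + iA + iB)
enters-lower a c iA oA iB p a≤c (inj₁ p<a) ge lt = ⊥-elim (<-irrefl refl (<-≤-trans p<a (≤-trans a≤c (≤-trans (m≤m+n c oA) (subst (c + oA ≤_) (past-left a iA oA p<a) ge)))))
enters-lower a c iA oA iB p a≤c (inj₂ le) ge lt with right-of {a} {iA} {p} le
... | r , refl , a≤r =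
  let e = past-right′ a iA oA {r} (≤-trans a≤r (m≤m+n r iA))
      c≤r = +-cancelʳ-≤ oA c r (subst (c + oA ≤_) e ge)
      r<ciB = +-cancelʳ-< oA r (c + iB) (subst (r + oA <_) (xy∙z≈xz∙y c oA iB) (subst (_< c + oA + iB) e lt))
  in  +-monoˡ-≤ iA c≤r , subst (r + iA <_) (xy∙z≈xz∙y c iB iA) (+-monoˡ-< iA r<ciB)

leaves-upper : ∀ a c oA iB oB j → a ≤ c → j < oA → past (c + oA) iB oB (a + j) ≡ a + j
leaves-upper a c oA iB oB j a≤c j<o = past-left (c + oA) iB oB (<-≤-trans (+-monoʳ-< a j<o) (+-monoˡ-≤ oA a≤c))

leaves-lower : ∀ a c iA oA j → a ≤ c → (past a iA oA ((c + iA) + j) ≡ (c + oA) + j) × Misses a iA ((c + iA) + j)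
leaves-lower a c iA oA j a≤c =
    trans (cong (past a iA oA) (xy∙z≈xz∙y c iA j)) (trans (past-right′ a iA oA (≤-trans a≤c (≤-trans (m≤m+n c j) (m≤m+n (c + j) iA)))) (xy∙z≈xz∙y c j oA))
  , inj₂ (≤-trans (+-monoˡ-≤ iA a≤c) (m≤m+n (c + iA) j))

no-adjacent-edge : ∀ a b oA j → j < oA → a + oA ≤ b → ¬ (b ≤ a + j)
no-adjacent-edge a b oA j j<o le ge = <-irrefl refl (<-≤-trans (+-monoʳ-< a j<o) (≤-trans le ge))

-- The quarter of the vertex at height a relative to an edge with source
-- at height b and target at height c: 0 above the source (or at the
-- target), 1 left of the wire, 2 below the target, 3 right of the wire;
-- `wireLeft` says that the wire passes left of the vertex.
quarterOf : ℕ → ℕ → ℕ → Bool → ℕ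
quarterOf a b c wireLeft = if a ≤ᵇ b then 0 else (if c ≤ᵇ a then (if a ≡ᵇ c then 0 else 2) else (if wireLeft then 3 else 1))

isSwap : ℕ → ℕ → ℕ → ℕ
isSwap n a b = if ((a ≡ᵇ n) ∧ (b ≡ᵇ suc n)) ∨ ((a ≡ᵇ suc n) ∧ (b ≡ᵇ n)) then 1 else 0

quarterOf-swap : ∀ n a b c sb sb' → NotSwapped n a b → NotSwapped n a c → (b < a → a < c → sb' ≡ sb) →
        quarterOf (swap n a) (swap n b) (swap n c) sb' ≡ quarterOf a b c sb
quarterOf-swap n a b c sb sb' nab nac hs
  rewrite swap-≤ᵇ n a b nab | swap-≤ᵇ n c a (NotSwapped-sym nac) | swap-≡ᵇ n a c
  with a ≤ᵇ b in e1
... | true = refl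
... | false with c ≤ᵇ a in e2
... | true = refl
... | false rewrite hs (≰⇒> (λ le → subst T e1 (≤⇒≤ᵇ le))) (≰⇒> (λ le → subst T e2 (≤⇒≤ᵇ le))) = refl

isSwap-0 : ∀ n a b → NotSwapped n a b → isSwap n a b ≡ 0
isSwap-0 n a b (h1 , h2) with a ≡ᵇ n in e1 | b ≡ᵇ suc n in e2 | a ≡ᵇ suc n in e3 | b ≡ᵇ n in e4
... | true | true | _ | _ = ⊥-elim (h1 (≡ᵇ⇒≡ a n (subst T (sym e1) tt) , ≡ᵇ⇒≡ b (suc n) (subst T (sym e2) tt)))
... | _ | _ | true | true = ⊥-elim (h2 (≡ᵇ⇒≡ a (suc n) (subst T (sym e3) tt) , ≡ᵇ⇒≡ b n (subst T (sym e4) tt)))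
... | false | _ | false | _ = refl
... | false | _ | true | false = refl
... | true | false | false | _ = refl
... | true | false | true | false = refl

isSwap-1 : ∀ n → isSwap n n (suc n) ≡ 1
isSwap-1 n rewrite ≡ᵇ-true {n} {n} refl = refl

isSwap-1′ : ∀ n → isSwap n (suc n) n ≡ 1
isSwap-1′ n rewrite ≡ᵇ-false {suc n} {n} 1+n≢n | ≡ᵇ-true {suc n} {suc n} refl = refl

by-values : ∀ {x y z w x' y' z' w' : ℕ} → x ≡ x' → y ≡ y' → z ≡ z' → w ≡ w' → x' + y' ≡ z' + 4 * w' → x + y ≡ z + 4 * w
by-values refl refl refl refl e = e

by-values₂ : ∀ {x y z w x' y' z' w' : ℕ} → x ≡ x' → y ≡ y' → z ≡ z' → w ≡ w' → x' + y' ≡ z' + w' → x + y ≡ z + w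
by-values₂ refl refl refl refl e = e

quarter-above : ∀ a b c sb → a ≤ b → quarterOf a b c sb ≡ 0
quarter-above a b c sb le rewrite ≤ᵇ-true le = refl

quarter-below : ∀ a b c sb → b < a → c < a → quarterOf a b c sb ≡ 2
quarter-below a b c sb lt ca rewrite ≤ᵇ-false lt | ≤ᵇ-true (<⇒≤ ca) | ≡ᵇ-false (>⇒≢ ca) = refl

quarter-right : ∀ a b c sb → b < a → a < c → sb ≡ true → quarterOf a b c sb ≡ 3
quarter-right a b c sb lt ac refl rewrite ≤ᵇ-false lt | ≤ᵇ-false ac = refl

quarter-left : ∀ a b c sb → b < a → a < c → sb ≡ false → quarterOf a b c sb ≡ 1
quarter-left a b c sb lt ac refl rewrite ≤ᵇ-false lt | ≤ᵇ-false ac = refl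

wrapsAt : ℕ → ℕ → ℕ → ℕ
wrapsAt n a b = if (a ≡ᵇ suc n) ∧ (b ≡ᵇ n) then 1 else 0

wraps-0 : ∀ n a b → ¬ (a ≡ suc n × b ≡ n) → wrapsAt n a b ≡ 0
wraps-0 n a b h with a ≡ᵇ suc n in e1 | b ≡ᵇ n in e2
... | true | true = ⊥-elim (h (≡ᵇ⇒≡ a (suc n) (subst T (sym e1) tt) , ≡ᵇ⇒≡ b n (subst T (sym e2) tt)))
... | true | false = refl
... | false | _ = refl

wraps-1 : ∀ n a b → a ≡ suc n → b ≡ n → wrapsAt n a b ≡ 1
wraps-1 n a b refl refl rewrite ≡ᵇ-true {n} refl = refl

quarterOf≤3 : ∀ a b c sb → quarterOf a b c sb ≤ 3
quarterOf≤3 a b c sb with a ≤ᵇ b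
... | true = z≤n
... | false with c ≤ᵇ a
... | true with a ≡ᵇ c
... | true = z≤n
... | false = s≤s (s≤s z≤n)
quarterOf≤3 a b c sb | false | false with sb
... | true = ≤-refl
... | false = s≤s z≤n


-- The arithmetic of one step of the potential invariant below: turn counts
-- cy, cy' grow by ty, ty'; quarters qy, qy' become ry, ry' with wraps wy,
-- wy'; and s, s' record whether f's source is left of g before and after.
potential-arith : ∀ cy cy' ty ty' qy qy' ry ry' s s' wy wy' P Q → cy + qy' + P ≡ cy' + (qy + 4 * s) + Q → ty + qy ≡ ry + 4 * wy →
      ty' + qy' ≡ ry' + 4 * wy' → s + wy ≡ s' + wy' → (cy + ty) + ry' + P ≡ (cy' + ty') + (ry + 4 * s') + Q
potential-arith cy cy' ty ty' qy qy' ry ry' s s' wy wy' P Q e1 e2 e3 e4 = +-cancelʳ-≡ _ _ _ (trans l (sym r))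
  where
    r1 : ∀ cy ty ry' P qy qy' → (cy + ty) + ry' + P + (qy + qy') ≡ (cy + qy' + P) + (ty + qy) + ry'
    r1 = solve-∀
    r2 : ∀ cy' qy s Q ry wy ry' → (cy' + (qy + 4 * s) + Q) + (ry + 4 * wy) + ry' ≡ cy' + qy + Q + ry + ry' + 4 * (s + wy)
    r2 = solve-∀
    r3 : ∀ cy' ty' ry s' Q qy qy' → (cy' + ty') + (ry + 4 * s') + Q + (qy + qy') ≡ (cy' + ry + 4 * s' + Q + qy) + (ty' + qy')
    r3 = solve-∀
    r4 : ∀ cy' ry s' Q qy ry' wy' → (cy' + ry + 4 * s' + Q + qy) + (ry' + 4 * wy') ≡ cy' + qy + Q + ry + ry' + 4 * (s' + wy')
    r4 = solve-∀
    l : (cy + ty) + ry' + P + (qy + qy') ≡ cy' + qy + Q + ry + ry' + 4 * (s' + wy')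
    l = trans (r1 cy ty ry' P qy qy') (trans (cong₂ (λ x y → x + y + ry') e1 e2) (trans (r2 cy' qy s Q ry wy ry') (cong (λ x → cy' + qy + Q + ry + ry' + 4 * x) e4)))
    r : (cy' + ty') + (ry + 4 * s') + Q + (qy + qy') ≡ cy' + qy + Q + ry + ry' + 4 * (s' + wy')
    r = trans (r3 cy' ty' ry s' Q qy qy') (trans (cong ((cy' + ry + 4 * s' + Q + qy) +_) e3) (r4 cy' ry s' Q qy ry' wy'))

-- An abstract right exchange at step k.  `Hk k ℓ`, `Ik k ℓ`, `Ok k ℓ` are the
-- interface of the vertex at height ℓ in the k-th diagram (0 beyond the last
-- height) and `xh k` is the height of the exchange: the vertex A at height
-- xh k and the vertex B at height xh k + 1 trade places.
record ExchangeStep (N : ℕ) (Hk Ik Ok : ℕ → ℕ → ℕ) (xh : ℕ → ℕ) (k : ℕ) : Set where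
  field
    in-range   : suc (xh k) < N
    admissible : Hk k (xh k) + Ok k (xh k) ≤ Hk k (suc (xh k))
    H-top      : Hk (suc k) (xh k) ≡ (Hk k (suc (xh k)) ∸ Ok k (xh k)) + Ik k (xh k)
    I-top      : Ik (suc k) (xh k) ≡ Ik k (suc (xh k))
    O-top      : Ok (suc k) (xh k) ≡ Ok k (suc (xh k))
    H-bot      : Hk (suc k) (suc (xh k)) ≡ Hk k (xh k)
    I-bot      : Ik (suc k) (suc (xh k)) ≡ Ik k (xh k)
    O-bot      : Ok (suc k) (suc (xh k)) ≡ Ok k (xh k)
    H-rest     : ∀ ℓ → ℓ ≢ xh k → ℓ ≢ suc (xh k) → Hk (suc k) ℓ ≡ Hk k ℓ
    I-rest     : ∀ ℓ → ℓ ≢ xh k → ℓ ≢ suc (xh k) → Ik (suc k) ℓ ≡ Ik k ℓ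
    O-rest     : ∀ ℓ → ℓ ≢ xh k → ℓ ≢ suc (xh k) → Ok (suc k) ℓ ≡ Ok k ℓ

module ExchangeSequence (N : ℕ) (Hk Ik Ok : ℕ → ℕ → ℕ) (xh : ℕ → ℕ) (exchange : ∀ k → ExchangeStep N Hk Ik Ok xh k) where

  module Step (k : ℕ) = ExchangeStep (exchange k)

  below : ℕ → ℕ → ℕ → ℕ
  below k ℓ q = past (Hk k ℓ) (Ik k ℓ) (Ok k ℓ) q

  track : ℕ → ℕ → ℕ → ℕ → ℕ
  track k s p zero = p
  track k s p (suc ℓ) = if s ≤ᵇ ℓ then below k ℓ (track k s p ℓ) else p

  track-before : ∀ k s p ℓ → ℓ ≤ s → track k s p ℓ ≡ p
  track-before k s p zero _ = refl
  track-before k s p (suc ℓ) le rewrite ≤ᵇ-false {s} {ℓ} le = refl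

  track-start : ∀ k s p → track k s p s ≡ p
  track-start k s p = track-before k s p s ≤-refl

  track-suc : ∀ k s p ℓ → s ≤ ℓ → track k s p (suc ℓ) ≡ below k ℓ (track k s p ℓ)
  track-suc k s p ℓ le rewrite ≤ᵇ-true le = refl

  track-agree : ∀ k k' s s' p p' L ℓ → s ≤ L → s' ≤ L → L ≤ ℓ → track k' s' p' L ≡ track k s p L →
          (∀ i → L ≤ i → i < ℓ → ∀ q → below k' i q ≡ below k i q) → track k' s' p' ℓ ≡ track k s p ℓ
  track-agree k k' s s' p p' L zero sL s'L Lℓ e h with n≤0⇒n≡0 Lℓ
  ... | refl = e
  track-agree k k' s s' p p' L (suc ℓ) sL s'L Lℓ e h with m≤n⇒m<n∨m≡n Lℓ
  ... | inj₂ refl = e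
  ... | inj₁ lt =
    let L≤ℓ = ≤-pred lt
        ih = track-agree k k' s s' p p' L ℓ sL s'L L≤ℓ e (λ i a b → h i a (≤-trans b (n≤1+n ℓ)))
    in  trans (track-suc k' s' p' ℓ (≤-trans s'L L≤ℓ))
          (trans (cong (below k' ℓ) ih) (trans (h ℓ L≤ℓ ≤-refl _) (sym (track-suc k s p ℓ (≤-trans sL L≤ℓ)))))

  below-unchanged : ∀ k ℓ → ℓ ≢ xh k → ℓ ≢ suc (xh k) → ∀ q → below (suc k) ℓ q ≡ below k ℓ q
  below-unchanged k ℓ p1 p2 q rewrite Step.H-rest k ℓ p1 p2 | Step.I-rest k ℓ p1 p2 | Step.O-rest k ℓ p1 p2 = refl

  -- The height in the k-th diagram of the vertex at height v in the first.
  height : ℕ → ℕ → ℕ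
  height zero v = v
  height (suc k) v = swap (xh k) (height k v)

  O-swap : ∀ k h → Ok (suc k) (swap (xh k) h) ≡ Ok k h
  O-swap k h with swapCase (xh k) h
  ... | at-n refl rewrite swap-n (xh k) = Step.O-bot k
  ... | at-suc refl rewrite swap-suc (xh k) = Step.O-top k
  ... | elsewhere p q rewrite swap-other (xh k) h p q = Step.O-rest k h p q

  -- An edge of the first diagram: the `port`-th output of `src` runs down to
  -- an input of `tgt`.  Its endpoints are followed through the sequence.
  record Edge : Set where
    constructor edge
    field
      src tgt : Fin N
      port    : ℕ

  srcH : ℕ → Edge → ℕ
  srcH k e = height k (toℕ (Edge.src e))

  tgtH : ℕ → Edge → ℕ
  tgtH k e = height k (toℕ (Edge.tgt e))

  wire : ℕ → Edge → ℕ → ℕ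
  wire k e = track k (suc (srcH k e)) (Hk k (srcH k e) + Edge.port e)

  Passes : ℕ → ℕ → ℕ → Set
  Passes k ℓ q = Misses (Hk k ℓ) (Ik k ℓ) q

  Enters : ℕ → ℕ → ℕ → Set
  Enters k ℓ q = Hk k ℓ ≤ q × q < Hk k ℓ + Ik k ℓ

  record EdgeInv (k : ℕ) (e : Edge) : Set where
    field
      downward : srcH k e < tgtH k e
      port<O   : Edge.port e < Ok k (srcH k e)
      passes   : ∀ ℓ → srcH k e < ℓ → ℓ < tgtH k e → Passes k ℓ (wire k e ℓ)
      enters   : Enters k (tgtH k e) (wire k e (tgtH k e))

  wire-start : ∀ k e → wire k e (suc (srcH k e)) ≡ Hk k (srcH k e) + Edge.port e
  wire-start k e = track-before k (suc (srcH k e)) _ (suc (srcH k e)) ≤-refl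

  -- By admissibility, the two vertices of an exchange are never joined by an edge.
  not-exchanged : ∀ k e → EdgeInv k e → ¬ (srcH k e ≡ xh k × tgtH k e ≡ suc (xh k))
  not-exchanged k e I (e1 , e2) =
    let j = Edge.port e
        j<oA : j < Ok k (xh k)
        j<oA = subst (λ h → j < Ok k h) e1 (EdgeInv.port<O I)
        g0 : Hk k (tgtH k e) ≤ wire k e (tgtH k e)
        g0 = proj₁ (EdgeInv.enters I)
        g1 : Hk k (suc (srcH k e)) ≤ wire k e (suc (srcH k e))
        g1 = subst (λ h → Hk k h ≤ wire k e h) (trans e2 (cong suc (sym e1))) g0
        g2 : Hk k (suc (xh k)) ≤ Hk k (xh k) + j
        g2 = subst₂ (λ h h' → Hk k (suc h) ≤ Hk k h' + j) e1 e1 (subst (Hk k (suc (srcH k e)) ≤_) (wire-start k e) g1)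
    in  no-adjacent-edge (Hk k (xh k)) (Hk k (suc (xh k))) (Ok k (xh k)) j j<oA (Step.admissible k) g2

  Passes-unchanged : ∀ k ℓ q → ℓ ≢ xh k → ℓ ≢ suc (xh k) → Passes k ℓ q → Passes (suc k) ℓ q
  Passes-unchanged k ℓ q p1 p2 P rewrite Step.H-rest k ℓ p1 p2 | Step.I-rest k ℓ p1 p2 = P

  Enters-unchanged : ∀ k ℓ q → ℓ ≢ xh k → ℓ ≢ suc (xh k) → Enters k ℓ q → Enters (suc k) ℓ q
  Enters-unchanged k ℓ q p1 p2 P rewrite Step.H-rest k ℓ p1 p2 | Step.I-rest k ℓ p1 p2 = P

  wire-at : ∀ k e zh ℓ → srcH k e ≡ zh → wire k e ℓ ≡ track k (suc zh) (Hk k zh + Edge.port e) ℓ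
  wire-at k e zh ℓ refl = refl

  record Transported (k : ℕ) (e : Edge) : Set where
    field
      inv  : EdgeInv (suc k) e
      same : ∀ ℓ → srcH (suc k) e < ℓ → ℓ ≤ tgtH (suc k) e → ℓ ≢ suc (xh k) → wire (suc k) e ℓ ≡ wire k e ℓ

  -- Notation: A is the
  -- vertex at height n with interface (a, iA, oA), B the vertex at height
  -- n + 1 with interface (c + oA, iB, oB); afterwards B has interface
  -- (c + iA, iB, oB) at height n and A keeps (a, iA, oA) at height n + 1.
  module AtExchange (k : ℕ) where
    open Step k
    n = xh k
    a = Hk k n
    b = Hk k (suc n)
    iA = Ik k n
    oA = Ok k n
    iB = Ik k (suc n)
    oB = Ok k (suc n)
    c = b ∸ oA
    oA≤b : oA ≤ b
    oA≤b = ≤-trans (m≤n+m oA a) admissible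
    b≡ : b ≡ c + oA
    b≡ = sym (m∸n+n≡m oA≤b)
    a≤c : a ≤ c
    a≤c = +-cancelʳ-≤ oA a c (subst (a + oA ≤_) b≡ admissible)
    Htop : Hk (suc k) n ≡ c + iA
    Htop = H-top
    below-top : ∀ q → below (suc k) n q ≡ past (c + iA) iB oB q
    below-top q rewrite H-top | I-top | O-top = refl
    below-bot : ∀ q → below (suc k) (suc n) q ≡ past a iA oA q
    below-bot q rewrite H-bot | I-bot | O-bot = refl
    below-B : ∀ q → below k (suc n) q ≡ past (c + oA) iB oB q
    below-B q = cong (λ h → past h iB oB q) b≡

    Passes-top : ∀ q → Misses (c + iA) iB q → Passes (suc k) n q
    Passes-top q P rewrite H-top | I-top = P
    Passes-bot : ∀ q → Misses a iA q → Passes (suc k) (suc n) q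
    Passes-bot q P rewrite H-bot | I-bot = P
    Enters-top : ∀ q → c + iA ≤ q → q < c + iA + iB → Enters (suc k) n q
    Enters-top q l u rewrite H-top | I-top = l , u
    Enters-bot : ∀ q → a ≤ q → q < a + iA → Enters (suc k) (suc n) q
    Enters-bot q l u rewrite H-bot | I-bot = l , u
    Passes-B : ∀ q → Passes k (suc n) q → Misses (c + oA) iB q
    Passes-B q P = subst (λ h → Misses h iB q) b≡ P
    Enters-B : ∀ q → Enters k (suc n) q → (c + oA ≤ q) × (q < c + oA + iB)
    Enters-B q (l , u) = subst (_≤ q) b≡ l , subst (λ h → q < h + iB) b≡ u

    wire-start-unchanged : ∀ e → srcH k e ≢ n → srcH k e ≢ suc n → ∀ ℓ → ℓ ≤ suc (srcH k e) → wire (suc k) e ℓ ≡ wire k e ℓ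
    wire-start-unchanged e p1 p2 ℓ le = begin
      wire (suc k) e ℓ                                                  ≡⟨ wire-at (suc k) e z0 ℓ (swap-other n z0 p1 p2) ⟩
      track (suc k) (suc z0) (Hk (suc k) z0 + Edge.port e) ℓ            ≡⟨ track-before (suc k) _ _ ℓ le ⟩
      Hk (suc k) z0 + Edge.port e                                       ≡⟨ cong (_+ Edge.port e) (H-rest z0 p1 p2) ⟩
      Hk k z0 + Edge.port e                                             ≡⟨ track-before k _ _ ℓ le ⟨
      wire k e ℓ                                                        ∎
      where
        open ≡-Reasoning
        z0 = srcH k e

    wire-above : ∀ e → srcH k e ≢ n → srcH k e ≢ suc n → ∀ ℓ → ℓ ≤ n → wire (suc k) e ℓ ≡ wire k e ℓ
    wire-above e p1 p2 ℓ ℓ≤n with ≤-total ℓ (suc (srcH k e))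
    ... | inj₁ le = wire-start-unchanged e p1 p2 ℓ le
    ... | inj₂ ge = trans (wire-at (suc k) e z0 ℓ eqz)
          (track-agree k (suc k) _ _ _ _ (suc z0) ℓ ≤-refl ≤-refl ge
            (trans (sym (wire-at (suc k) e z0 (suc z0) eqz)) (wire-start-unchanged e p1 p2 (suc z0) ≤-refl))
            (λ i _ i<ℓ q → below-unchanged k i (λ eq → <-irrefl eq (<-≤-trans i<ℓ ℓ≤n))
                                               (λ eq → <-irrefl refl (<-trans (subst (_< n) eq (<-≤-trans i<ℓ ℓ≤n)) (n<1+n n))) q))
      where
        z0 = srcH k e
        eqz = swap-other n z0 p1 p2

    wire-below : ∀ e L → suc (suc n) ≤ L → suc (srcH k e) ≤ L → suc (srcH (suc k) e) ≤ L → wire (suc k) e L ≡ wire k e L →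
           ∀ ℓ → L ≤ ℓ → wire (suc k) e ℓ ≡ wire k e ℓ
    wire-below e L nL s L' eq ℓ Lℓ = track-agree k (suc k) _ _ _ _ L ℓ s L' Lℓ eq
      (λ i Li _ q → below-unchanged k i (λ eq → <-irrefl (sym eq) (≤-trans (n≤1+n (suc n)) (≤-trans nL Li)))
                                 (λ eq → <-irrefl (sym eq) (≤-trans nL Li)) q)

    wire-past-A : ∀ e → srcH k e < n → wire k e (suc n) ≡ past a iA oA (wire k e n)
    wire-past-A e zl = track-suc k _ _ n zl

    wire-past-B′ : ∀ e → srcH k e < n → wire (suc k) e (suc n) ≡ past (c + iA) iB oB (wire k e n)
    wire-past-B′ e zl = trans (wire-at (suc k) e (srcH k e) (suc n) eqz)
                       (trans (track-suc (suc k) _ _ n zl) (trans (below-top _) (cong (past (c + iA) iB oB)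
                         (trans (sym (wire-at (suc k) e (srcH k e) n eqz)) (wire-above e zn zsn n ≤-refl)))))
      where
        zn = <⇒≢ zl
        zsn = <⇒≢ (<-trans zl (n<1+n n))
        eqz = swap-other n (srcH k e) zn zsn

    enters-at : ∀ e → EdgeInv k e → ∀ h → tgtH k e ≡ h → Enters k h (wire k e h)
    enters-at e I h eq = subst (λ h → Enters k h (wire k e h)) eq (EdgeInv.enters I)

    passes-above : ∀ e → EdgeInv k e → srcH k e < n → ∀ ℓ → srcH k e < ℓ → ℓ < n → ℓ < tgtH k e → Passes (suc k) ℓ (wire (suc k) e ℓ)
    passes-above e I zl ℓ zℓ ℓn ℓx rewrite wire-above e (<⇒≢ zl) (<⇒≢ (<-trans zl (n<1+n n))) ℓ (<⇒≤ ℓn) =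
      Passes-unchanged k ℓ _ (<⇒≢ ℓn) (<⇒≢ (<-trans ℓn (n<1+n n))) (EdgeInv.passes I ℓ zℓ ℓx)

    Shape : Edge → ℕ → ℕ → Set
    Shape e zh th = (∀ ℓ → zh < ℓ → ℓ < th → Passes (suc k) ℓ (wire (suc k) e ℓ))
                  × Enters (suc k) th (wire (suc k) e th)
                  × (∀ ℓ → zh < ℓ → ℓ ≤ th → ℓ ≢ suc n → wire (suc k) e ℓ ≡ wire k e ℓ)

    Shape-at : ∀ e zh th → srcH (suc k) e ≡ zh → tgtH (suc k) e ≡ th → Shape e zh th → Shape e (srcH (suc k) e) (tgtH (suc k) e)
    Shape-at e zh th refl refl x = x

    shape-above : ∀ e → EdgeInv k e → tgtH k e < n → Shape e (srcH (suc k) e) (tgtH (suc k) e)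
    shape-above e I lt = Shape-at e z0 x0 eqz eqx (ps , en , (λ ℓ _ ℓx _ → lw ℓ (≤-trans ℓx (<⇒≤ lt))))
      where
        z0 = srcH k e
        x0 = tgtH k e
        zlt = <-trans (EdgeInv.downward I) lt
        zn = <⇒≢ zlt
        zsn = <⇒≢ (<-trans zlt (n<1+n n))
        eqz : srcH (suc k) e ≡ z0
        eqz = swap-other n z0 zn zsn
        eqx : tgtH (suc k) e ≡ x0
        eqx = swap-other n x0 (<⇒≢ lt) (<⇒≢ (<-trans lt (n<1+n n)))
        lw = wire-above e zn zsn
        ps : ∀ ℓ → z0 < ℓ → ℓ < x0 → Passes (suc k) ℓ (wire (suc k) e ℓ)
        ps ℓ zl lx rewrite lw ℓ (<⇒≤ (<-trans lx lt)) = Passes-unchanged k ℓ _ (<⇒≢ (<-trans lx lt)) (<⇒≢ (<-trans (<-trans lx lt) (n<1+n n))) (EdgeInv.passes I ℓ zl lx)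
        en : Enters (suc k) x0 (wire (suc k) e x0)
        en rewrite lw x0 (<⇒≤ lt) = Enters-unchanged k x0 _ (<⇒≢ lt) (<⇒≢ (<-trans lt (n<1+n n))) (EdgeInv.enters I)

    shape-below : ∀ e → EdgeInv k e → suc n < srcH k e → Shape e (srcH (suc k) e) (tgtH (suc k) e)
    shape-below e I lt = Shape-at e z0 x0 eqz eqx (ps , en , (λ ℓ _ _ _ → all ℓ))
      where
        z0 = srcH k e
        x0 = tgtH k e
        zn : z0 ≢ n
        zn = >⇒≢ (<-trans (n<1+n n) lt)
        zsn : z0 ≢ suc n
        zsn = >⇒≢ lt
        eqz : srcH (suc k) e ≡ z0
        eqz = swap-other n z0 zn zsn
        xlt : suc n < x0
        xlt = <-trans lt (EdgeInv.downward I)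
        eqx : tgtH (suc k) e ≡ x0
        eqx = swap-other n x0 (>⇒≢ (<-trans (n<1+n n) xlt)) (>⇒≢ xlt)
        all : ∀ ℓ → wire (suc k) e ℓ ≡ wire k e ℓ
        all ℓ with ≤-total ℓ (suc z0)
        ... | inj₁ le = wire-start-unchanged e zn zsn ℓ le
        ... | inj₂ ge = wire-below e (suc z0) (≤-trans lt (n≤1+n z0)) ≤-refl (≤-reflexive (cong suc eqz))
                          (wire-start-unchanged e zn zsn (suc z0) ≤-refl) ℓ ge
        ps : ∀ ℓ → z0 < ℓ → ℓ < x0 → Passes (suc k) ℓ (wire (suc k) e ℓ)
        ps ℓ zl lx rewrite all ℓ = Passes-unchanged k ℓ _ (>⇒≢ (<-trans (n<1+n n) (<-trans lt zl))) (>⇒≢ (<-trans lt zl)) (EdgeInv.passes I ℓ zl lx)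
        en : Enters (suc k) x0 (wire (suc k) e x0)
        en rewrite all x0 = Enters-unchanged k x0 _ (>⇒≢ (<-trans (n<1+n n) xlt)) (>⇒≢ xlt) (EdgeInv.enters I)

    shape-enters-A : ∀ e → EdgeInv k e → tgtH k e ≡ n → Shape e (srcH (suc k) e) (tgtH (suc k) e)
    shape-enters-A e I ex = Shape-at e z0 (suc n) eqz eqx (ps , en , sm)
      where
        z0 = srcH k e
        zl : z0 < n
        zl = subst (z0 <_) ex (EdgeInv.downward I)
        zn = <⇒≢ zl
        zsn = <⇒≢ (<-trans zl (n<1+n n))
        eqz : srcH (suc k) e ≡ z0
        eqz = swap-other n z0 zn zsn
        eqx : tgtH (suc k) e ≡ suc n
        eqx = trans (cong (swap n) ex) (swap-n n)
        lw = wire-above e zn zsn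
        IR = enters-at e I n ex
        EA = enters-upper a c iA iB oB (wire k e n) a≤c (proj₂ IR)
        ps : ∀ ℓ → z0 < ℓ → ℓ < suc n → Passes (suc k) ℓ (wire (suc k) e ℓ)
        ps ℓ zℓ ℓsn with m≤n⇒m<n∨m≡n (≤-pred ℓsn)
        ... | inj₁ ℓn = passes-above e I zl ℓ zℓ ℓn (subst (ℓ <_) (sym ex) ℓn)
        ... | inj₂ refl rewrite lw n ≤-refl = Passes-top _ (inj₁ (proj₁ EA))
        en : Enters (suc k) (suc n) (wire (suc k) e (suc n))
        en rewrite wire-past-B′ e zl | proj₂ EA = Enters-bot _ (proj₁ IR) (proj₂ IR)
        sm : ∀ ℓ → z0 < ℓ → ℓ ≤ suc n → ℓ ≢ suc n → wire (suc k) e ℓ ≡ wire k e ℓ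
        sm ℓ _ ℓsn ne with m≤n⇒m<n∨m≡n ℓsn
        ... | inj₁ lt = lw ℓ (≤-pred lt)
        ... | inj₂ eq = ⊥-elim (ne eq)

    -- The edge enters B (its source is then above A, as A and B are not adjacent).
    shape-enters-B : ∀ e → EdgeInv k e → tgtH k e ≡ suc n → srcH k e < n → Shape e (srcH (suc k) e) (tgtH (suc k) e)
    shape-enters-B e I ex zl = Shape-at e z0 n eqz eqx (ps , en , sm)
      where
        z0 = srcH k e
        zn = <⇒≢ zl
        zsn = <⇒≢ (<-trans zl (n<1+n n))
        eqz : srcH (suc k) e ≡ z0
        eqz = swap-other n z0 zn zsn
        eqx : tgtH (suc k) e ≡ n
        eqx = trans (cong (swap n) ex) (swap-suc n)
        lw = wire-above e zn zsn
        IR = Enters-B _ (enters-at e I (suc n) ex)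
        PAn = EdgeInv.passes I n zl (subst (n <_) (sym ex) (n<1+n n))
        EB = enters-lower a c iA oA iB (wire k e n) a≤c PAn (subst (c + oA ≤_) (wire-past-A e zl) (proj₁ IR)) (subst (_< c + oA + iB) (wire-past-A e zl) (proj₂ IR))
        ps : ∀ ℓ → z0 < ℓ → ℓ < n → Passes (suc k) ℓ (wire (suc k) e ℓ)
        ps ℓ zℓ ℓn = passes-above e I zl ℓ zℓ ℓn (subst (ℓ <_) (sym ex) (<-trans ℓn (n<1+n n)))
        en : Enters (suc k) n (wire (suc k) e n)
        en rewrite lw n ≤-refl = Enters-top _ (proj₁ EB) (proj₂ EB)
        sm : ∀ ℓ → z0 < ℓ → ℓ ≤ n → ℓ ≢ suc n → wire (suc k) e ℓ ≡ wire k e ℓ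
        sm ℓ _ ℓn _ = lw ℓ ℓn

    -- The edge runs beside both exchanged vertices; here `exchange-commutes`
    -- does the work.  The side of each vertex on which the wire runs is kept.
    module BothPassed (e : Edge) (I : EdgeInv k e) (zl : srcH k e < n) (xg : suc n < tgtH k e) where
      z0 = srcH k e
      x0 = tgtH k e
      zn = <⇒≢ zl
      zsn = <⇒≢ (<-trans zl (n<1+n n))
      eqz : srcH (suc k) e ≡ z0
      eqz = swap-other n z0 zn zsn
      eqx : tgtH (suc k) e ≡ x0
      eqx = swap-other n x0 (>⇒≢ (<-trans (n<1+n n) xg)) (>⇒≢ xg)
      lw = wire-above e zn zsn
      p = wire k e n
      PA : Misses a iA p
      PA = EdgeInv.passes I n zl (<-trans (n<1+n n) xg)
      PB : Misses (c + oA) iB (past a iA oA p)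
      PB = subst (Misses (c + oA) iB) (wire-past-A e zl) (Passes-B _ (EdgeInv.passes I (suc n) (<-trans zl (n<1+n n)) xg))
      commutes : Commutes a c iA oA iB oB p
      commutes = exchange-commutes a c iA oA iB oB p a≤c PA PB
      open Commutes commutes
      rejoins : wire (suc k) e (suc (suc n)) ≡ wire k e (suc (suc n))
      rejoins = begin
        wire (suc k) e (suc (suc n))                   ≡⟨ wire-at (suc k) e z0 (suc (suc n)) eqz ⟩
        track (suc k) (suc z0) _ (suc (suc n))         ≡⟨ track-suc (suc k) (suc z0) _ (suc n) (s≤s (<⇒≤ zl)) ⟩
        below (suc k) (suc n) (track (suc k) (suc z0) _ (suc n))
                                                       ≡⟨ below-bot _ ⟩
        past a iA oA (track (suc k) (suc z0) _ (suc n)) ≡⟨ cong (past a iA oA) (trans (sym (wire-at (suc k) e z0 (suc n) eqz)) (wire-past-B′ e zl)) ⟩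
        past a iA oA (past (c + iA) iB oB p)           ≡⟨ same-exit ⟩
        past (c + oA) iB oB (past a iA oA p)           ≡⟨ cong (past (c + oA) iB oB) (wire-past-A e zl) ⟨
        past (c + oA) iB oB (wire k e (suc n))         ≡⟨ below-B _ ⟨
        below k (suc n) (wire k e (suc n))             ≡⟨ track-suc k (suc z0) _ (suc n) (s≤s (<⇒≤ zl)) ⟨
        wire k e (suc (suc n))                         ∎
        where open ≡-Reasoning
      hi : ∀ ℓ → suc (suc n) ≤ ℓ → wire (suc k) e ℓ ≡ wire k e ℓ
      hi = wire-below e (suc (suc n)) ≤-refl (s≤s (<⇒≤ (<-trans zl (n<1+n n)))) (s≤s (subst (_≤ suc n) (sym eqz) (<⇒≤ (<-trans zl (n<1+n n))))) rejoins
      ps : ∀ ℓ → z0 < ℓ → ℓ < x0 → Passes (suc k) ℓ (wire (suc k) e ℓ)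
      ps ℓ zℓ ℓx with <-cmp ℓ n
      ... | tri< ℓn _ _ = passes-above e I zl ℓ zℓ ℓn ℓx
      ... | tri≈ _ refl _ rewrite lw n ≤-refl = Passes-top _ misses-B
      ... | tri> _ _ nℓ with m≤n⇒m<n∨m≡n nℓ
      ... | inj₂ refl rewrite wire-past-B′ e zl = Passes-bot _ misses-A
      ... | inj₁ snℓ rewrite hi ℓ snℓ = Passes-unchanged k ℓ _ (>⇒≢ (<-trans (n<1+n n) snℓ)) (>⇒≢ snℓ) (EdgeInv.passes I ℓ zℓ ℓx)
      en : Enters (suc k) x0 (wire (suc k) e x0)
      en rewrite hi x0 xg = Enters-unchanged k x0 _ (>⇒≢ (<-trans (n<1+n n) xg)) (>⇒≢ xg) (EdgeInv.enters I)
      sm : ∀ ℓ → z0 < ℓ → ℓ ≤ x0 → ℓ ≢ suc n → wire (suc k) e ℓ ≡ wire k e ℓ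
      sm ℓ _ _ ne with ≤-total ℓ n
      ... | inj₁ le = lw ℓ le
      ... | inj₂ ge with m≤n⇒m<n∨m≡n ge
      ... | inj₂ refl = lw n ≤-refl
      ... | inj₁ lt with m≤n⇒m<n∨m≡n lt
      ... | inj₂ eq = ⊥-elim (ne (sym eq))
      ... | inj₁ lt2 = hi ℓ lt2
      shape-crossing : Shape e (srcH (suc k) e) (tgtH (suc k) e)
      shape-crossing = Shape-at e z0 x0 eqz eqx (ps , en , sm)
      side-of-A : (wire (suc k) e (suc n) <ᵇ Hk (suc k) (suc n)) ≡ (wire k e n <ᵇ Hk k n)
      side-of-A rewrite wire-past-B′ e zl | H-bot = side-A
      side-of-B : (wire (suc k) e n <ᵇ Hk (suc k) n) ≡ (wire k e (suc n) <ᵇ Hk k (suc n))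
      side-of-B rewrite lw n ≤-refl | H-top | wire-past-A e zl = trans side-B (cong (past a iA oA p <ᵇ_) (sym b≡))

    shape-leaves-A : ∀ e → EdgeInv k e → srcH k e ≡ n → Shape e (srcH (suc k) e) (tgtH (suc k) e)
    shape-leaves-A e I ez = Shape-at e (suc n) x0 eqz eqx (ps , en , sm)
      where
        x0 = tgtH k e
        j = Edge.port e
        xg : suc n < x0
        xg with m≤n⇒m<n∨m≡n (subst (_< x0) ez (EdgeInv.downward I))
        ... | inj₁ lt = lt
        ... | inj₂ eq = ⊥-elim (not-exchanged k e I (ez , sym eq))
        eqz : srcH (suc k) e ≡ suc n
        eqz = trans (cong (swap n) ez) (swap-n n)
        eqx : tgtH (suc k) e ≡ x0
        eqx = swap-other n x0 (>⇒≢ (<-trans (n<1+n n) xg)) (>⇒≢ xg)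
        jo : j < oA
        jo = subst (λ h → j < Ok k h) ez (EdgeInv.port<O I)
        o2 : wire k e (suc (suc n)) ≡ a + j
        o2 = trans (wire-at k e n (suc (suc n)) ez) (trans (track-suc k (suc n) _ (suc n) ≤-refl)
               (trans (below-B _) (trans (cong (past (c + oA) iB oB) (track-start k (suc n) _)) (leaves-upper a c oA iB oB j a≤c jo))))
        n2 : wire (suc k) e (suc (suc n)) ≡ a + j
        n2 = trans (wire-at (suc k) e (suc n) (suc (suc n)) eqz) (trans (track-start (suc k) (suc (suc n)) _) (cong (_+ j) H-bot))
        hi : ∀ ℓ → suc (suc n) ≤ ℓ → wire (suc k) e ℓ ≡ wire k e ℓ
        hi = wire-below e (suc (suc n)) ≤-refl (s≤s (≤-trans (≤-reflexive ez) (n≤1+n n))) (s≤s (≤-reflexive eqz)) (trans n2 (sym o2))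
        ps : ∀ ℓ → suc n < ℓ → ℓ < x0 → Passes (suc k) ℓ (wire (suc k) e ℓ)
        ps ℓ snℓ ℓx rewrite hi ℓ snℓ = Passes-unchanged k ℓ _ (>⇒≢ (<-trans (n<1+n n) snℓ)) (>⇒≢ snℓ)
                                         (EdgeInv.passes I ℓ (subst (_< ℓ) (sym ez) (<-trans (n<1+n n) snℓ)) ℓx)
        en : Enters (suc k) x0 (wire (suc k) e x0)
        en rewrite hi x0 xg = Enters-unchanged k x0 _ (>⇒≢ (<-trans (n<1+n n) xg)) (>⇒≢ xg) (EdgeInv.enters I)
        sm : ∀ ℓ → suc n < ℓ → ℓ ≤ x0 → ℓ ≢ suc n → wire (suc k) e ℓ ≡ wire k e ℓ
        sm ℓ snℓ _ _ = hi ℓ snℓ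

    shape-leaves-B : ∀ e → EdgeInv k e → srcH k e ≡ suc n → Shape e (srcH (suc k) e) (tgtH (suc k) e)
    shape-leaves-B e I ez = Shape-at e n x0 eqz eqx (ps , en , sm)
      where
        x0 = tgtH k e
        j = Edge.port e
        xg : suc n < x0
        xg = subst (_< x0) ez (EdgeInv.downward I)
        eqz : srcH (suc k) e ≡ n
        eqz = trans (cong (swap n) ez) (swap-suc n)
        eqx : tgtH (suc k) e ≡ x0
        eqx = swap-other n x0 (>⇒≢ (<-trans (n<1+n n) xg)) (>⇒≢ xg)
        SB = leaves-lower a c iA oA j a≤c
        n1 : wire (suc k) e (suc n) ≡ (c + iA) + j
        n1 = trans (wire-at (suc k) e n (suc n) eqz) (trans (track-start (suc k) (suc n) _) (cong (_+ j) Htop))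
        n2 : wire (suc k) e (suc (suc n)) ≡ (c + oA) + j
        n2 = trans (wire-at (suc k) e n (suc (suc n)) eqz) (trans (track-suc (suc k) (suc n) _ (suc n) ≤-refl)
               (trans (below-bot _) (trans (cong (past a iA oA) (trans (sym (wire-at (suc k) e n (suc n) eqz)) n1)) (proj₁ SB))))
        o2 : wire k e (suc (suc n)) ≡ (c + oA) + j
        o2 = trans (wire-at k e (suc n) (suc (suc n)) ez) (trans (track-start k (suc (suc n)) _) (cong (_+ j) b≡))
        hi : ∀ ℓ → suc (suc n) ≤ ℓ → wire (suc k) e ℓ ≡ wire k e ℓ
        hi = wire-below e (suc (suc n)) ≤-refl (s≤s (≤-reflexive ez)) (s≤s (≤-trans (≤-reflexive eqz) (n≤1+n n))) (trans n2 (sym o2))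
        ps : ∀ ℓ → n < ℓ → ℓ < x0 → Passes (suc k) ℓ (wire (suc k) e ℓ)
        ps ℓ nℓ ℓx with m≤n⇒m<n∨m≡n nℓ
        ... | inj₂ refl rewrite n1 = Passes-bot _ (proj₂ SB)
        ... | inj₁ snℓ rewrite hi ℓ snℓ = Passes-unchanged k ℓ _ (>⇒≢ (<-trans (n<1+n n) snℓ)) (>⇒≢ snℓ)
                                             (EdgeInv.passes I ℓ (subst (_< ℓ) (sym ez) snℓ) ℓx)
        en : Enters (suc k) x0 (wire (suc k) e x0)
        en rewrite hi x0 xg = Enters-unchanged k x0 _ (>⇒≢ (<-trans (n<1+n n) xg)) (>⇒≢ xg) (EdgeInv.enters I)
        sm : ∀ ℓ → n < ℓ → ℓ ≤ x0 → ℓ ≢ suc n → wire (suc k) e ℓ ≡ wire k e ℓ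
        sm ℓ nℓ _ ne with m≤n⇒m<n∨m≡n nℓ
        ... | inj₂ eq = ⊥-elim (ne (sym eq))
        ... | inj₁ snℓ = hi ℓ snℓ

    shape : ∀ e → EdgeInv k e → Shape e (srcH (suc k) e) (tgtH (suc k) e)
    shape e I with swapCase n (srcH k e)
    ... | at-n ez = shape-leaves-A e I ez
    ... | at-suc ez = shape-leaves-B e I ez
    ... | elsewhere p q with swapCase n (tgtH k e)
    ... | at-n ex = shape-enters-A e I ex
    ... | at-suc ex = shape-enters-B e I ex (≤∧≢⇒< (≤-pred (subst (srcH k e <_) ex (EdgeInv.downward I))) p)
    ... | elsewhere p' q' with <-cmp (srcH k e) n
    ... | tri> _ _ nz = shape-below e I (≤∧≢⇒< nz (λ eq → q (sym eq)))
    ... | tri≈ _ eq _ = ⊥-elim (p eq)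
    ... | tri< zl _ _ with <-cmp (tgtH k e) n
    ... | tri< xl _ _ = shape-above e I xl
    ... | tri≈ _ eq _ = ⊥-elim (p' eq)
    ... | tri> _ _ nx = BothPassed.shape-crossing e I zl (≤∧≢⇒< nx (λ eq → q' (sym eq)))

  transport : ∀ k e → EdgeInv k e → Transported k e
  transport k e I = record
    { inv = record
      { downward = swap-< (xh k) (EdgeInv.downward I) (not-exchanged k e I)
      ; port<O = subst (Edge.port e <_) (sym (O-swap k (srcH k e))) (EdgeInv.port<O I)
      ; passes = proj₁ r
      ; enters = proj₁ (proj₂ r) }
    ; same = proj₂ (proj₂ r) }
    where r = AtExchange.shape k e I

  edgeInv-forever : ∀ e → EdgeInv 0 e → ∀ k → EdgeInv k e
  edgeInv-forever e I zero = I
  edgeInv-forever e I (suc k) = Transported.inv (transport k e (edgeInv-forever e I k))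

  wireLeftOf : ℕ → Edge → ℕ → Bool
  wireLeftOf k e v = wire k e (height k v) <ᵇ Hk k (height k v)

  quarter : ℕ → Edge → ℕ → ℕ
  quarter k e v = quarterOf (height k v) (srcH k e) (tgtH k e) (wireLeftOf k e v)

  turns : ℕ → ℕ → Edge → ℕ
  turns k v e = isSwap (xh k) (height k v) (srcH k e) + isSwap (xh k) (height k v) (tgtH k e)

  -- 1 if at step k the vertex v moves up past the source of e, completing a
  -- full turn (quarter 3 → 0).
  wraps : ℕ → ℕ → Edge → ℕ
  wraps k v e = wrapsAt (xh k) (height k v) (srcH k e)

  -- One exchange advances the quarter of every vertex v by the number of
  -- endpoints of e that v is exchanged with, modulo 4 (`quarter-step`).

  module QuarterStep (k : ℕ) (e : Edge) (I : EdgeInv k e) where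
    open AtExchange k
    hs = srcH k e
    ht = tgtH k e
    transported = transport k e I
    j = Edge.port e

    wireLeftOf-elsewhere : ∀ v → height k v ≢ n → height k v ≢ suc n → hs < height k v → height k v < ht → wireLeftOf (suc k) e v ≡ wireLeftOf k e v
    wireLeftOf-elsewhere v p q lt1 lt2 =
      trans (cong (λ h → wire (suc k) e h <ᵇ Hk (suc k) h) (swap-other n (height k v) p q))
        (cong₂ _<ᵇ_ (Transported.same transported (height k v)
                       (subst (swap n hs <_) (swap-other n (height k v) p q) (swap-< n lt1 (λ { (_ , y) → q y })))
                       (<⇒≤ (subst (_< swap n ht) (swap-other n (height k v) p q) (swap-< n lt2 (λ { (x , _) → p x }))))
                       q)
                    (Step.H-rest k (height k v) p q))

    wireLeftOf-at-A : ∀ v → height k v ≡ n → hs < n → suc n < ht → wireLeftOf (suc k) e v ≡ wireLeftOf k e v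
    wireLeftOf-at-A v pa zl xg = trans (cong (λ h → wire (suc k) e h <ᵇ Hk (suc k) h) (trans (cong (swap n) pa) (swap-n n)))
                         (trans (BothPassed.side-of-A e I zl xg) (cong (λ h → wire k e h <ᵇ Hk k h) (sym pa)))

    wireLeftOf-at-B : ∀ v → height k v ≡ suc n → hs < n → suc n < ht → wireLeftOf (suc k) e v ≡ wireLeftOf k e v
    wireLeftOf-at-B v pa zl xg = trans (cong (λ h → wire (suc k) e h <ᵇ Hk (suc k) h) (trans (cong (swap n) pa) (swap-suc n)))
                          (trans (BothPassed.side-of-B e I zl xg) (cong (λ h → wire k e h <ᵇ Hk k h) (sym pa)))

    wireLeftOf-preserved : ∀ v → NotSwapped n (height k v) hs → NotSwapped n (height k v) ht → hs < height k v → height k v < ht → wireLeftOf (suc k) e v ≡ wireLeftOf k e v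
    wireLeftOf-preserved v nab nac lt1 lt2 with swapCase n (height k v)
    ... | at-n pa = wireLeftOf-at-A v pa (subst (hs <_) pa lt1) (≤∧≢⇒< (subst (_< ht) pa lt2) (λ eq → proj₁ nac (pa , sym eq)))
    ... | at-suc pa = wireLeftOf-at-B v pa (≤∧≢⇒< (≤-pred (subst (hs <_) pa lt1)) (λ eq → proj₂ nab (pa , eq))) (subst (_< ht) pa lt2)
    ... | elsewhere pa qa = wireLeftOf-elsewhere v pa qa lt1 lt2

    Advances : ℕ → Set
    Advances v = turns k v e + quarter k e v ≡ quarter (suc k) e v + 4 * wraps k v e

    quarter-untouched : ∀ v → NotSwapped n (height k v) hs → NotSwapped n (height k v) ht → Advances v
    quarter-untouched v nab nac = by-values (cong₂ _+_ (isSwap-0 n _ _ nab) (isSwap-0 n _ _ nac)) refl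
      (quarterOf-swap n (height k v) hs ht (wireLeftOf k e v) (wireLeftOf (suc k) e v) nab nac (wireLeftOf-preserved v nab nac))
      (wraps-0 n _ _ (proj₂ nab)) (sym (+-identityʳ _))

    hs<ht : hs < ht
    hs<ht = EdgeInv.downward I

    -- v moves down past the source: from above it (0) to the left of the wire (1).
    quarter-down-past-src : ∀ v → height k v ≡ n → hs ≡ suc n → Advances v
    quarter-down-past-src v pa pb = by-values (cong₂ _+_ i1 i2) t0 t1 w0 refl
      where
        a0 = height k v
        xg : suc n < ht
        xg = subst (_< ht) pb hs<ht
        i1 : isSwap n a0 hs ≡ 1
        i1 = subst₂ (λ x y → isSwap n x y ≡ 1) (sym pa) (sym pb) (isSwap-1 n)
        i2 : isSwap n a0 ht ≡ 0
        i2 = isSwap-0 n a0 ht (NotSwapped-right (>⇒≢ (<-trans (n<1+n n) xg)) (>⇒≢ xg))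
        t0 : quarterOf a0 hs ht (wireLeftOf k e v) ≡ 0
        t0 = quarter-above a0 hs ht _ (subst₂ _≤_ (sym pa) (sym pb) (n≤1+n n))
        sa : swap n a0 ≡ suc n
        sa = trans (cong (swap n) pa) (swap-n n)
        sb : swap n hs ≡ n
        sb = trans (cong (swap n) pb) (swap-suc n)
        sc : swap n ht ≡ ht
        sc = swap-other n ht (>⇒≢ (<-trans (n<1+n n) xg)) (>⇒≢ xg)
        sd : wireLeftOf (suc k) e v ≡ false
        sd = trans (cong (λ h → wire (suc k) e h <ᵇ Hk (suc k) h) sa)
               (trans (cong₂ _<ᵇ_ (trans (wire-at (suc k) e n (suc n) sb) (trans (track-start (suc k) (suc n) _) (cong (_+ j) Htop))) (Step.H-bot k))
                 (<ᵇ-false (≤-trans a≤c (≤-trans (m≤m+n c iA) (m≤m+n (c + iA) j)))))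
        t1 : quarterOf (swap n a0) (swap n hs) (swap n ht) (wireLeftOf (suc k) e v) ≡ 1
        t1 = quarter-left _ _ _ _ (subst₂ _<_ (sym sb) (sym sa) (n<1+n n)) (subst₂ _<_ (sym sa) (sym sc) xg) sd
        w0 : wraps k v e ≡ 0
        w0 = wraps-0 n a0 hs (λ { (x , _) → 1+n≢n (trans (sym x) pa) })

    -- v moves up past the source: from the right of the wire (3) to above it (0).
    quarter-up-past-src : ∀ v → height k v ≡ suc n → hs ≡ n → Advances v
    quarter-up-past-src v pa pb = by-values (cong₂ _+_ i1 i2) t0 t1 w1 refl
      where
        a0 = height k v
        xg : suc n < ht
        xg with m≤n⇒m<n∨m≡n (subst (_< ht) pb hs<ht)
        ... | inj₁ lt = lt
        ... | inj₂ eq = ⊥-elim (not-exchanged k e I (pb , sym eq))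
        i1 : isSwap n a0 hs ≡ 1
        i1 = subst₂ (λ x y → isSwap n x y ≡ 1) (sym pa) (sym pb) (isSwap-1′ n)
        i2 : isSwap n a0 ht ≡ 0
        i2 = isSwap-0 n a0 ht (NotSwapped-right (>⇒≢ (<-trans (n<1+n n) xg)) (>⇒≢ xg))
        jo : j < oA
        jo = subst (λ h → j < Ok k h) pb (EdgeInv.port<O I)
        sd : wireLeftOf k e v ≡ true
        sd = trans (cong (λ h → wire k e h <ᵇ Hk k h) pa)
               (trans (cong (_<ᵇ b) (trans (wire-at k e n (suc n) pb) (track-start k (suc n) _)))
                 (<ᵇ-true (<-≤-trans (+-monoʳ-< a jo) (Step.admissible k))))
        t0 : quarterOf a0 hs ht (wireLeftOf k e v) ≡ 3
        t0 = quarter-right a0 hs ht _ (subst₂ _<_ (sym pb) (sym pa) (n<1+n n)) (subst (_< ht) (sym pa) xg) sd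
        sa : swap n a0 ≡ n
        sa = trans (cong (swap n) pa) (swap-suc n)
        sb : swap n hs ≡ suc n
        sb = trans (cong (swap n) pb) (swap-n n)
        t1 : quarterOf (swap n a0) (swap n hs) (swap n ht) (wireLeftOf (suc k) e v) ≡ 0
        t1 = quarter-above (swap n a0) (swap n hs) (swap n ht) (wireLeftOf (suc k) e v) (subst₂ _≤_ (sym sa) (sym sb) (n≤1+n n))
        w1 : wraps k v e ≡ 1
        w1 = wraps-1 n a0 hs pa pb

    -- v moves down past the target: from the left of the wire (1) to below it (2).
    quarter-down-past-tgt : ∀ v → height k v ≡ n → ht ≡ suc n → Advances v
    quarter-down-past-tgt v pa pc = by-values (cong₂ _+_ i1 i2) t0 t1 w0 refl
      where
        a0 = height k v
        zl : hs < n
        zl = ≤∧≢⇒< (≤-pred (subst (hs <_) pc hs<ht)) (λ eq → not-exchanged k e I (eq , pc))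
        i1 : isSwap n a0 hs ≡ 0
        i1 = isSwap-0 n a0 hs (NotSwapped-right (<⇒≢ zl) (<⇒≢ (<-trans zl (n<1+n n))))
        i2 : isSwap n a0 ht ≡ 1
        i2 = subst₂ (λ x y → isSwap n x y ≡ 1) (sym pa) (sym pc) (isSwap-1 n)
        PAn = EdgeInv.passes I n zl (subst (n <_) (sym pc) (n<1+n n))
        IR = Enters-B _ (enters-at e I (suc n) pc)
        ge : a ≤ wire k e n
        ge with PAn
        ... | inj₂ le = ≤-trans (m≤m+n a iA) le
        ... | inj₁ lt = ⊥-elim (<-irrefl refl (<-≤-trans lt (≤-trans a≤c (≤-trans (m≤m+n c oA)
                          (subst (c + oA ≤_) (trans (wire-past-A e zl) (past-left a iA oA lt)) (proj₁ IR))))))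
        sd : wireLeftOf k e v ≡ false
        sd = trans (cong (λ h → wire k e h <ᵇ Hk k h) pa) (<ᵇ-false ge)
        t0 : quarterOf a0 hs ht (wireLeftOf k e v) ≡ 1
        t0 = quarter-left a0 hs ht _ (subst (hs <_) (sym pa) zl) (subst₂ _<_ (sym pa) (sym pc) (n<1+n n)) sd
        sa : swap n a0 ≡ suc n
        sa = trans (cong (swap n) pa) (swap-n n)
        sb : swap n hs ≡ hs
        sb = swap-other n hs (<⇒≢ zl) (<⇒≢ (<-trans zl (n<1+n n)))
        sc : swap n ht ≡ n
        sc = trans (cong (swap n) pc) (swap-suc n)
        t1 : quarterOf (swap n a0) (swap n hs) (swap n ht) (wireLeftOf (suc k) e v) ≡ 2
        t1 = quarter-below _ _ _ _ (subst₂ _<_ (sym sb) (sym sa) (<-trans zl (n<1+n n))) (subst₂ _<_ (sym sc) (sym sa) (n<1+n n))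
        w0 : wraps k v e ≡ 0
        w0 = wraps-0 n a0 hs (λ { (x , _) → 1+n≢n (trans (sym x) pa) })

    -- v moves up past the target: from below it (2) to the right of the wire (3).
    quarter-up-past-tgt : ∀ v → height k v ≡ suc n → ht ≡ n → Advances v
    quarter-up-past-tgt v pa pc = by-values (cong₂ _+_ i1 i2) t0 t1 w0 refl
      where
        a0 = height k v
        zl : hs < n
        zl = subst (hs <_) pc hs<ht
        i1 : isSwap n a0 hs ≡ 0
        i1 = isSwap-0 n a0 hs (NotSwapped-right (<⇒≢ zl) (<⇒≢ (<-trans zl (n<1+n n))))
        i2 : isSwap n a0 ht ≡ 1
        i2 = subst₂ (λ x y → isSwap n x y ≡ 1) (sym pa) (sym pc) (isSwap-1′ n)
        t0 : quarterOf a0 hs ht (wireLeftOf k e v) ≡ 2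
        t0 = quarter-below a0 hs ht _ (subst (hs <_) (sym pa) (<-trans zl (n<1+n n))) (subst₂ _<_ (sym pc) (sym pa) (n<1+n n))
        sa : swap n a0 ≡ n
        sa = trans (cong (swap n) pa) (swap-suc n)
        sb : swap n hs ≡ hs
        sb = swap-other n hs (<⇒≢ zl) (<⇒≢ (<-trans zl (n<1+n n)))
        sc : swap n ht ≡ suc n
        sc = trans (cong (swap n) pc) (swap-n n)
        IR = enters-at e I n pc
        epn : wire (suc k) e n ≡ wire k e n
        epn = Transported.same transported n (subst (_< n) (sym sb) zl) (subst (n ≤_) (sym sc) (n≤1+n n)) (λ eq → 1+n≢n (sym eq))
        sd : wireLeftOf (suc k) e v ≡ true
        sd = trans (cong (λ h → wire (suc k) e h <ᵇ Hk (suc k) h) sa)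
               (trans (cong₂ _<ᵇ_ epn Htop) (<ᵇ-true (<-≤-trans (proj₂ IR) (+-monoˡ-≤ iA a≤c))))
        t1 : quarterOf (swap n a0) (swap n hs) (swap n ht) (wireLeftOf (suc k) e v) ≡ 3
        t1 = quarter-right _ _ _ _ (subst₂ _<_ (sym sb) (sym sa) zl) (subst₂ _<_ (sym sa) (sym sc) (n<1+n n)) sd
        w0 : wraps k v e ≡ 0
        w0 = wraps-0 n a0 hs (λ { (_ , y) → <⇒≢ zl y })

    quarter-step : ∀ v → Advances v
    quarter-step v with swapCase n (height k v) | swapCase n hs | swapCase n ht
    ... | at-n pa | at-n pb | _ = quarter-untouched v (NotSwapped-same (trans pa (sym pb)))
            ((λ { (_ , y) → not-exchanged k e I (pb , y) }) , (λ { (x , _) → 1+n≢n (trans (sym x) pa) }))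
    ... | at-n pa | at-suc pb | _ = quarter-down-past-src v pa pb
    ... | at-n pa | elsewhere pb qb | at-n pc = quarter-untouched v (NotSwapped-right pb qb) (NotSwapped-same (trans pa (sym pc)))
    ... | at-n pa | elsewhere pb qb | at-suc pc = quarter-down-past-tgt v pa pc
    ... | at-n pa | elsewhere pb qb | elsewhere pc qc = quarter-untouched v (NotSwapped-right pb qb) (NotSwapped-right pc qc)
    ... | at-suc pa | at-n pb | _ = quarter-up-past-src v pa pb
    ... | at-suc pa | at-suc pb | _ = quarter-untouched v (NotSwapped-same (trans pa (sym pb)))
            (NotSwapped-right (>⇒≢ (<-trans (n<1+n n) tgt-below)) (>⇒≢ tgt-below))
      where
        tgt-below : suc n < ht
        tgt-below = subst (_< ht) pb hs<ht
    ... | at-suc pa | elsewhere pb qb | at-n pc = quarter-up-past-tgt v pa pc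
    ... | at-suc pa | elsewhere pb qb | at-suc pc = quarter-untouched v (NotSwapped-right pb qb) (NotSwapped-same (trans pa (sym pc)))
    ... | at-suc pa | elsewhere pb qb | elsewhere pc qc = quarter-untouched v (NotSwapped-right pb qb) (NotSwapped-right pc qc)
    ... | elsewhere pa qa | _ | _ = quarter-untouched v (NotSwapped-left pa qa) (NotSwapped-left pa qa)

  srcLeftOf? : ℕ → Edge → Edge → Bool
  srcLeftOf? k g f = (srcH k g <ᵇ srcH k f) ∧ ((srcH k f <ᵇ tgtH k g) ∧ not (wireLeftOf k g (toℕ (Edge.src f))))

  srcLeftOf : ℕ → Edge → Edge → ℕ
  srcLeftOf k g f = if srcLeftOf? k g f then 1 else 0

  module SrcLeftOfStep (k : ℕ) (g f : Edge) (Ig : EdgeInv k g) where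
    open AtExchange k
    open QuarterStep k g Ig using (wireLeftOf-preserved; transported)
    Y = srcH k g
    Y' = tgtH k g
    Z = srcH k f
    y = toℕ (Edge.src g)
    y' = toℕ (Edge.tgt g)
    z = toℕ (Edge.src f)
    jg = Edge.port g

    Balanced : Set
    Balanced = srcLeftOf k g f + wraps k y f ≡ srcLeftOf (suc k) g f + wraps k y' f

    indicator-cong : ∀ {b b'} → b ≡ b' → (if b then 1 else 0) ≡ (if b' then 1 else 0)
    indicator-cong refl = refl

    -- The source of f moves down past y: y completes a turn, and f's source
    -- arrives left of g.
    f-down-past-src : Y ≡ suc n → Z ≡ n → Balanced
    f-down-past-src py pz = by-values₂ s0 w1 s1 w0 refl
      where
        yg : suc n < Y'
        yg = subst (_< Y') py (EdgeInv.downward Ig)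
        s0 : srcLeftOf k g f ≡ 0
        s0 = indicator-cong {b' = false} (cong (λ x → x ∧ ((Z <ᵇ Y') ∧ not (wireLeftOf k g z))) (<ᵇ-false (subst₂ _≤_ (sym pz) (sym py) (n≤1+n n))))
        w1 : wraps k y f ≡ 1
        w1 = wraps-1 n Y Z py pz
        sY : swap n Y ≡ n
        sY = trans (cong (swap n) py) (swap-suc n)
        sZ : swap n Z ≡ suc n
        sZ = trans (cong (swap n) pz) (swap-n n)
        sY' : swap n Y' ≡ Y'
        sY' = swap-other n Y' (>⇒≢ (<-trans (n<1+n n) yg)) (>⇒≢ yg)
        sd : wireLeftOf (suc k) g z ≡ false
        sd = trans (cong (λ h → wire (suc k) g h <ᵇ Hk (suc k) h) sZ)
               (trans (cong₂ _<ᵇ_ (trans (wire-at (suc k) g n (suc n) sY) (trans (track-start (suc k) (suc n) _) (cong (_+ jg) Htop))) (Step.H-bot k))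
                 (<ᵇ-false (≤-trans a≤c (≤-trans (m≤m+n c iA) (m≤m+n (c + iA) jg)))))
        s1 : srcLeftOf (suc k) g f ≡ 1
        s1 = indicator-cong {b' = true}
               (trans (cong₂ _∧_ (trans (cong₂ _<ᵇ_ sY sZ) (<ᵇ-true (n<1+n n)))
                        (cong₂ _∧_ (trans (cong₂ _<ᵇ_ sZ sY') (<ᵇ-true yg)) (cong not sd))) refl)
        w0 : wraps k y' f ≡ 0
        w0 = wraps-0 n Y' Z (λ { (x , _) → >⇒≢ yg x })

    src-above : Y' ≡ suc n → Y < n
    src-above py' = ≤∧≢⇒< (≤-pred (subst (Y <_) py' (EdgeInv.downward Ig))) (λ eq → not-exchanged k g Ig (eq , py'))

    right-of-A : Y' ≡ suc n → a ≤ wire k g n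
    right-of-A py' with EdgeInv.passes Ig n (src-above py') (subst (n <_) (sym py') (n<1+n n))
    ... | inj₂ le = ≤-trans (m≤m+n a iA) le
    ... | inj₁ lt = ⊥-elim (<-irrefl refl (<-≤-trans lt (≤-trans a≤c (≤-trans (m≤m+n c oA)
                      (subst (c + oA ≤_) (trans (wire-past-A g (src-above py')) (past-left a iA oA lt)) (proj₁ (Enters-B _ (enters-at g Ig (suc n) py'))))))))

    -- The source of f moves down past y': y' completes a turn, and f's source
    -- leaves the region left of g.
    f-down-past-tgt : Y' ≡ suc n → Z ≡ n → Balanced
    f-down-past-tgt py' pz = by-values₂ s1 w0 s0 w1 refl
      where
        Yl = src-above py'
        sd : wireLeftOf k g z ≡ false
        sd = trans (cong (λ h → wire k g h <ᵇ Hk k h) pz) (<ᵇ-false (right-of-A py'))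
        s1 : srcLeftOf k g f ≡ 1
        s1 = indicator-cong {b' = true} (cong₂ _∧_ (<ᵇ-true (subst (Y <_) (sym pz) Yl))
                                   (cong₂ _∧_ (<ᵇ-true (subst₂ _<_ (sym pz) (sym py') (n<1+n n))) (cong not sd)))
        w0 : wraps k y f ≡ 0
        w0 = wraps-0 n Y Z (λ { (x , _) → <⇒≢ (<-trans Yl (n<1+n n)) x })
        sZ : swap n Z ≡ suc n
        sZ = trans (cong (swap n) pz) (swap-n n)
        sY' : swap n Y' ≡ n
        sY' = trans (cong (swap n) py') (swap-suc n)
        s0 : srcLeftOf (suc k) g f ≡ 0
        s0 = indicator-cong {b' = false} (trans (cong (λ x → (swap n Y <ᵇ swap n Z) ∧ (x ∧ not (wireLeftOf (suc k) g z)))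
                                           (trans (cong₂ _<ᵇ_ sZ sY') (<ᵇ-false (n≤1+n n)))) (∧-zeroʳ _))
        w1 : wraps k y' f ≡ 1
        w1 = wraps-1 n Y' Z py' pz

    -- The source of f moves up past y from the right of g: nothing to count.
    f-up-past-src : Y ≡ n → Z ≡ suc n → Balanced
    f-up-past-src py pz = by-values₂ s0 w0 s0' w0' refl
      where
        jo : jg < oA
        jo = subst (λ h → jg < Ok k h) py (EdgeInv.port<O Ig)
        sd : wireLeftOf k g z ≡ true
        sd = trans (cong (λ h → wire k g h <ᵇ Hk k h) pz)
               (trans (cong (_<ᵇ b) (trans (wire-at k g n (suc n) py) (track-start k (suc n) _)))
                 (<ᵇ-true (<-≤-trans (+-monoʳ-< a jo) (Step.admissible k))))
        s0 : srcLeftOf k g f ≡ 0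
        s0 = indicator-cong {b' = false} (trans (cong (λ x → (Y <ᵇ Z) ∧ ((Z <ᵇ Y') ∧ not x)) sd)
                                     (trans (cong ((Y <ᵇ Z) ∧_) (∧-zeroʳ (Z <ᵇ Y'))) (∧-zeroʳ _)))
        w0 : wraps k y f ≡ 0
        w0 = wraps-0 n Y Z (λ { (x , _) → 1+n≢n (trans (sym x) py) })
        s0' : srcLeftOf (suc k) g f ≡ 0
        s0' = indicator-cong {b' = false} (cong (λ x → x ∧ ((swap n Z <ᵇ swap n Y') ∧ not (wireLeftOf (suc k) g z)))
                 (trans (cong₂ _<ᵇ_ (trans (cong (swap n) py) (swap-n n)) (trans (cong (swap n) pz) (swap-suc n))) (<ᵇ-false (n≤1+n n))))
        w0' : wraps k y' f ≡ 0
        w0' = wraps-0 n Y' Z (λ { (_ , x) → 1+n≢n (trans (sym pz) x) })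

    -- The source of f moves up past y' and arrives right of g: nothing to count.
    f-up-past-tgt : Z ≡ suc n → Y' ≡ n → Balanced
    f-up-past-tgt pz py' = by-values₂ s0 w0 s0' w0' refl
      where
        Yl : Y < n
        Yl = subst (Y <_) py' (EdgeInv.downward Ig)
        s0 : srcLeftOf k g f ≡ 0
        s0 = indicator-cong {b' = false} (trans (cong (λ x → (Y <ᵇ Z) ∧ (x ∧ not (wireLeftOf k g z)))
                                           (trans (cong₂ _<ᵇ_ pz py') (<ᵇ-false (n≤1+n n)))) (∧-zeroʳ _))
        w0 : wraps k y f ≡ 0
        w0 = wraps-0 n Y Z (λ { (x , _) → <⇒≢ (<-trans Yl (n<1+n n)) x })
        sY : swap n Y ≡ Y
        sY = swap-other n Y (<⇒≢ Yl) (<⇒≢ (<-trans Yl (n<1+n n)))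
        sZ : swap n Z ≡ n
        sZ = trans (cong (swap n) pz) (swap-suc n)
        sY' : swap n Y' ≡ suc n
        sY' = trans (cong (swap n) py') (swap-n n)
        epn : wire (suc k) g n ≡ wire k g n
        epn = Transported.same transported n (subst (_< n) (sym sY) Yl) (subst (n ≤_) (sym sY') (n≤1+n n)) (λ eq → 1+n≢n (sym eq))
        IR = enters-at g Ig n py'
        sd : wireLeftOf (suc k) g z ≡ true
        sd = trans (cong (λ h → wire (suc k) g h <ᵇ Hk (suc k) h) sZ)
               (trans (cong₂ _<ᵇ_ epn Htop) (<ᵇ-true (<-≤-trans (proj₂ IR) (+-monoˡ-≤ iA a≤c))))
        s0' : srcLeftOf (suc k) g f ≡ 0
        s0' = indicator-cong {b' = false} (trans (cong (λ x → (swap n Y <ᵇ swap n Z) ∧ ((swap n Z <ᵇ swap n Y') ∧ not x)) sd)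
                                     (trans (cong ((swap n Y <ᵇ swap n Z) ∧_) (∧-zeroʳ _)) (∧-zeroʳ _)))
        w0' : wraps k y' f ≡ 0
        w0' = wraps-0 n Y' Z (λ { (x , _) → 1+n≢n (trans (sym x) py') })

    srcLeftOf?-swap : NotSwapped n Y Z → NotSwapped n Z Y' →
           ((swap n Y <ᵇ swap n Z) ∧ ((swap n Z <ᵇ swap n Y') ∧ not (wireLeftOf (suc k) g z))) ≡ ((Y <ᵇ Z) ∧ ((Z <ᵇ Y') ∧ not (wireLeftOf k g z)))
    srcLeftOf?-swap nyz nzy rewrite swap-<ᵇ n Y Z nyz | swap-<ᵇ n Z Y' nzy
      with Y <ᵇ Z in e1
    ... | false = refl
    ... | true with Z <ᵇ Y' in e2
    ... | false = refl
    ... | true rewrite wireLeftOf-preserved z (NotSwapped-sym nyz) nzy (<ᵇ⇒< Y Z (subst T (sym e1) tt)) (<ᵇ⇒< Z Y' (subst T (sym e2) tt)) = refl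

    srcLeftOf-untouched : NotSwapped n Y Z → NotSwapped n Z Y' → Balanced
    srcLeftOf-untouched nyz nzy = by-values₂ refl (wraps-0 n Y Z (proj₂ nyz)) (indicator-cong (srcLeftOf?-swap nyz nzy)) (wraps-0 n Y' Z (λ { (p , q) → proj₁ nzy (q , p) })) refl

    srcLeftOf-step : Balanced
    srcLeftOf-step with (Y ≟ suc n) ×-dec (Z ≟ n)
    ... | yes (py , pz) = f-down-past-src py pz
    ... | no h1 with (Y' ≟ suc n) ×-dec (Z ≟ n)
    ... | yes (py' , pz) = f-down-past-tgt py' pz
    ... | no h2 with (Y ≟ n) ×-dec (Z ≟ suc n)
    ... | yes (py , pz) = f-up-past-src py pz
    ... | no h3 with (Z ≟ suc n) ×-dec (Y' ≟ n)
    ... | yes (pz , py') = f-up-past-tgt pz py'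
    ... | no h4 = srcLeftOf-untouched (h3 , h1) ((λ { (p , q) → h2 (q , p) }) , h4)

  turnCount : ℕ → ℕ → Edge → ℕ
  turnCount zero v e = 0
  turnCount (suc k) v e = turnCount k v e + turns k v e

  turnCount-mono : ∀ k v e → turnCount k v e ≤ turnCount (suc k) v e
  turnCount-mono k v e = m≤m+n _ _

  turnCount-src : ∀ e → (∀ k → EdgeInv k e) → ∀ k → turnCount k (toℕ (Edge.src e)) e ≡ 0
  turnCount-src e I zero = refl
  turnCount-src e I (suc k) rewrite turnCount-src e I k =
    cong₂ _+_ (isSwap-0 (xh k) (srcH k e) (srcH k e) (NotSwapped-same refl))
              (isSwap-0 (xh k) (srcH k e) (tgtH k e) (not-exchanged k e (I k) , (λ { (p , q) → <-asym (EdgeInv.downward (I k)) (subst₂ _<_ (sym q) (sym p) (n<1+n (xh k))) })))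

  quarter≤3 : ∀ k e v → quarter k e v ≤ 3
  quarter≤3 k e v = quarterOf≤3 (height k v) (srcH k e) (tgtH k e) (wireLeftOf k e v)

  srcLeftOf≤1 : ∀ k g f → srcLeftOf k g f ≤ 1
  srcLeftOf≤1 k g f with srcLeftOf? k g f
  ... | true = ≤-refl
  ... | false = z≤n

  Φ : ℕ → Edge → Edge → ℕ
  Φ k g f = quarter k f (toℕ (Edge.src g)) + 4 * srcLeftOf k g f

  Φ≤7 : ∀ k g f → Φ k g f ≤ 7
  Φ≤7 k g f = +-mono-≤ (quarter≤3 k f (toℕ (Edge.src g))) (*-monoʳ-≤ 4 (srcLeftOf≤1 k g f))

  potential-invariant : ∀ g f → (∀ k → EdgeInv k g) → (∀ k → EdgeInv k f) → ∀ k →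
         turnCount k (toℕ (Edge.src g)) f + quarter k f (toℕ (Edge.tgt g)) + Φ 0 g f ≡ turnCount k (toℕ (Edge.tgt g)) f + Φ k g f + quarter 0 f (toℕ (Edge.tgt g))
  potential-invariant g f Ig If zero = +-comm (quarter 0 f (toℕ (Edge.tgt g))) (Φ 0 g f)
  potential-invariant g f Ig If (suc k) =
    potential-arith (turnCount k y f) (turnCount k y' f) (turns k y f) (turns k y' f) (quarter k f y) (quarter k f y') (quarter (suc k) f y) (quarter (suc k) f y')
        (srcLeftOf k g f) (srcLeftOf (suc k) g f) (wraps k y f) (wraps k y' f) (Φ 0 g f) (quarter 0 f y') (potential-invariant g f Ig If k)
        (QuarterStep.quarter-step k f (If k) (toℕ (Edge.src g))) (QuarterStep.quarter-step k f (If k) (toℕ (Edge.tgt g))) (SrcLeftOfStep.srcLeftOf-step k g f (Ig k))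
    where
      y = toℕ (Edge.src g)
      y' = toℕ (Edge.tgt g)

  bounded-difference : ∀ {a b x x' y y' d} → a + x + x' ≡ b + y + y' → y + y' ≤ d → a ≤ b + d
  bounded-difference {a} {b} {x} {x'} {y} {y'} {d} eq le = begin
    a             ≤⟨ m≤m+n a (x + x') ⟩
    a + (x + x')  ≡⟨ +-assoc a x x' ⟨
    a + x + x'    ≡⟨ eq ⟩
    b + y + y'    ≡⟨ +-assoc b y y' ⟩
    b + (y + y')  ≤⟨ +-monoʳ-≤ b le ⟩
    b + d         ∎
    where open ≤-Reasoning

  turnCount-along : ∀ g f → (∀ k → EdgeInv k g) → (∀ k → EdgeInv k f) → ∀ k →
                    (turnCount k (toℕ (Edge.src g)) f ≤ turnCount k (toℕ (Edge.tgt g)) f + 10)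
                  × (turnCount k (toℕ (Edge.tgt g)) f ≤ turnCount k (toℕ (Edge.src g)) f + 10)
  turnCount-along g f Ig If k =
      bounded-difference invariant (+-mono-≤ (Φ≤7 k g f) (quarter≤3 0 f (toℕ (Edge.tgt g))))
    , bounded-difference (sym invariant) (+-mono-≤ (quarter≤3 k f (toℕ (Edge.tgt g))) (Φ≤7 0 g f))
    where invariant = potential-invariant g f Ig If k

  swap-in-range : ∀ k ℓ → ℓ < N → swap (xh k) ℓ < N
  swap-in-range k ℓ lt with swapCase (xh k) ℓ
  ... | at-n refl rewrite swap-n (xh k) = Step.in-range k
  ... | at-suc refl rewrite swap-suc (xh k) = <-trans (n<1+n (xh k)) (Step.in-range k)
  ... | elsewhere p q rewrite swap-other (xh k) ℓ p q = lt

  height-onto : ∀ k ℓ → ℓ < N → Σ (Fin N) λ v → height k (toℕ v) ≡ ℓ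
  height-onto zero ℓ lt = fromℕ< lt , FP.toℕ-fromℕ< lt
  height-onto (suc k) ℓ lt with height-onto k (swap (xh k) ℓ) (swap-in-range k ℓ lt)
  ... | v , eq = v , trans (cong (swap (xh k)) eq) (swap-involutive (xh k) ℓ)

  sumFin : (m : ℕ) → (Fin m → ℕ) → ℕ
  sumFin zero f = 0
  sumFin (suc m) f = f F.zero + sumFin m (λ i → f (F.suc i))

  sumFin-mono : ∀ m (f g : Fin m → ℕ) → (∀ i → f i ≤ g i) → sumFin m f ≤ sumFin m g
  sumFin-mono zero f g h = z≤n
  sumFin-mono (suc m) f g h = +-mono-≤ (h F.zero) (sumFin-mono m _ _ (λ i → h (F.suc i)))

  sumFin-strict : ∀ m (f g : Fin m → ℕ) → (∀ i → f i ≤ g i) → (i0 : Fin m) → f i0 < g i0 → sumFin m f < sumFin m g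
  sumFin-strict (suc m) f g h F.zero lt = +-mono-<-≤ lt (sumFin-mono m _ _ (λ i → h (F.suc i)))
  sumFin-strict (suc m) f g h (F.suc i0) lt = +-mono-≤-< (h F.zero) (sumFin-strict m _ _ (λ i → h (F.suc i)) i0 lt)

  pathLength : ∀ {A : Set} {R : A → A → Set} {a b} → Star R a b → ℕ
  pathLength ε = 0
  pathLength (_ ◅ s) = suc (pathLength s)

  turnCount-grows : ∀ k v e → height k v ≡ xh k → (srcH k e ≡ suc (xh k)) ⊎ (tgtH k e ≡ suc (xh k)) →
                    turnCount k v e < turnCount (suc k) v e
  turnCount-grows k v e hv hit = m<m+n (turnCount k v e) (one-turn hit)
    where
      swapped : ∀ {h} → h ≡ suc (xh k) → isSwap (xh k) (height k v) h ≡ 1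
      swapped hh = subst₂ (λ x y → isSwap (xh k) x y ≡ 1) (sym hv) (sym hh) (isSwap-1 (xh k))
      one-turn : (srcH k e ≡ suc (xh k)) ⊎ (tgtH k e ≡ suc (xh k)) → 0 < turns k v e
      one-turn (inj₁ hs) = subst (_≤ turns k v e) (swapped hs) (m≤m+n _ _)
      one-turn (inj₂ ht) = subst (_≤ turns k v e) (swapped ht) (m≤n+m _ _)

  record Realisation (a b : Fin N) : Set where
    field
      edgeOf : Edge
      src≡   : Edge.src edgeOf ≡ a
      tgt≡   : Edge.tgt edgeOf ≡ b
      inv₀   : EdgeInv 0 edgeOf

  module Counting (R : Fin N → Fin N → Set) (realise : ∀ {a b} → R a b → Realisation a b)
                  (conn : ∀ u v → Star (SymClosure R) u v) where

    linkEdge : ∀ {u w} → SymClosure R u w → Edge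
    linkEdge (fwd r) = Realisation.edgeOf (realise r)
    linkEdge (bwd r) = Realisation.edgeOf (realise r)

    linkInv : ∀ {u w} (s : SymClosure R u w) → ∀ k → EdgeInv k (linkEdge s)
    linkInv (fwd r) = edgeInv-forever _ (Realisation.inv₀ (realise r))
    linkInv (bwd r) = edgeInv-forever _ (Realisation.inv₀ (realise r))

    turnCount-link : ∀ {u w} (s : SymClosure R u w) f → (∀ k → EdgeInv k f) → ∀ k →
                     turnCount k (toℕ u) f ≤ turnCount k (toℕ w) f + 10
    turnCount-link (fwd r) f If k = subst₂ (λ x y → turnCount k (toℕ x) f ≤ turnCount k (toℕ y) f + 10) src≡ tgt≡
                                      (proj₁ (turnCount-along edgeOf f (linkInv (fwd r)) If k))
      where open Realisation (realise r)
    turnCount-link (bwd r) f If k = subst₂ (λ x y → turnCount k (toℕ y) f ≤ turnCount k (toℕ x) f + 10) src≡ tgt≡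
                                      (proj₂ (turnCount-along edgeOf f (linkInv (bwd r)) If k))
      where open Realisation (realise r)

    turnCount-path : ∀ {u w} (p : Star (SymClosure R) u w) f → (∀ k → EdgeInv k f) → ∀ k →
                     turnCount k (toℕ u) f ≤ turnCount k (toℕ w) f + 10 * pathLength p
    turnCount-path ε f If k = m≤m+n _ _
    turnCount-path {u} {w} (_◅_ {j = w'} s p) f If k = begin
      turnCount k (toℕ u) f                              ≤⟨ turnCount-link s f If k ⟩
      turnCount k (toℕ w') f + 10                        ≤⟨ +-monoˡ-≤ 10 (turnCount-path p f If k) ⟩
      turnCount k (toℕ w) f + 10 * pathLength p + 10     ≡⟨ ten-more (turnCount k (toℕ w) f) (pathLength p) ⟩
      turnCount k (toℕ w) f + 10 * suc (pathLength p)    ∎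
      where
        open ≤-Reasoning
        ten-more : ∀ x l → x + 10 * l + 10 ≡ x + 10 * suc l
        ten-more = solve-∀

    -- For the pair (a, b): how often a turned around the first edge of the
    -- chosen path from b to a, and a bound on it via the path from a to that
    -- edge's source.
    weight : ℕ → (a : Fin N) → ∀ {b} → Star (SymClosure R) b a → ℕ
    weight k a ε = 0
    weight k a (s ◅ _) = turnCount k (toℕ a) (linkEdge s)

    weightBound : (a : Fin N) → ∀ {b} → Star (SymClosure R) b a → ℕ
    weightBound a ε = 0
    weightBound a (s ◅ _) = 10 * pathLength (conn a (Edge.src (linkEdge s)))

    weight-bounded : ∀ k a {b} (p : Star (SymClosure R) b a) → weight k a p ≤ weightBound a p
    weight-bounded k a ε = z≤n
    weight-bounded k a (s ◅ _) =
      subst (λ x → turnCount k (toℕ a) e ≤ x + 10 * pathLength (conn a (Edge.src e))) (turnCount-src e (linkInv s) k)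
            (turnCount-path (conn a (Edge.src e)) e (linkInv s) k)
      where e = linkEdge s

    weight-mono : ∀ k a {b} (p : Star (SymClosure R) b a) → weight k a p ≤ weight (suc k) a p
    weight-mono k a ε = z≤n
    weight-mono k a (s ◅ _) = turnCount-mono k (toℕ a) (linkEdge s)

    -- When A (at height xh k) is exchanged with B, the path from B to A starts
    -- with an edge at B, around which A turns.
    weight-grows : ∀ k (A B : Fin N) → height k (toℕ A) ≡ xh k → height k (toℕ B) ≡ suc (xh k) →
                   (p : Star (SymClosure R) B A) → weight k A p < weight (suc k) A p
    weight-grows k A .A hA hB ε = ⊥-elim (1+n≢n (trans (sym hB) hA))
    weight-grows k A B hA hB (fwd r ◅ _) =
      turnCount-grows k (toℕ A) edgeOf hA (inj₁ (trans (cong (λ x → height k (toℕ x)) src≡) hB))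
      where open Realisation (realise r)
    weight-grows k A B hA hB (bwd r ◅ _) =
      turnCount-grows k (toℕ A) edgeOf hA (inj₂ (trans (cong (λ x → height k (toℕ x)) tgt≡) hB))
      where open Realisation (realise r)

    total : ℕ → ℕ
    total k = sumFin N (λ a → sumFin N (λ b → weight k a (conn b a)))

    totalBound : ℕ
    totalBound = sumFin N (λ a → sumFin N (λ b → weightBound a (conn b a)))

    total-bounded : ∀ k → total k ≤ totalBound
    total-bounded k = sumFin-mono N _ _ (λ a → sumFin-mono N _ _ (λ b → weight-bounded k a (conn b a)))

    total-grows : ∀ k → total k < total (suc k)
    total-grows k =
      sumFin-strict N _ _ (λ a → sumFin-mono N _ _ (λ b → weight-mono k a (conn b a))) A
        (sumFin-strict N _ _ (λ b → weight-mono k A (conn b A)) B (weight-grows k A B hA hB (conn B A)))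
      where
        A = proj₁ (height-onto k (xh k) (<-trans (n<1+n (xh k)) (Step.in-range k)))
        hA = proj₂ (height-onto k (xh k) (<-trans (n<1+n (xh k)) (Step.in-range k)))
        B = proj₁ (height-onto k (suc (xh k)) (Step.in-range k))
        hB = proj₂ (height-onto k (suc (xh k)) (Step.in-range k))

    total≥ : ∀ k → k ≤ total k
    total≥ zero = z≤n
    total≥ (suc k) = ≤-trans (s≤s (total≥ k)) (total-grows k)

    absurd : ⊥
    absurd = ≤⇒≯ (total-bounded (suc totalBound)) (total≥ (suc totalBound))

at-lt : ∀ {N} (f : Fin N → ℕ) ℓ (p : ℓ < N) → at f ℓ ≡ f (fromℕ< p)
at-lt {N} f ℓ p with ℓ <? N
... | yes q = cong f (FP.fromℕ<-cong ℓ ℓ refl q p)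
... | no ¬q = ⊥-elim (¬q p)

at-out : ∀ {N} (f : Fin N → ℕ) ℓ → ¬ ℓ < N → at f ℓ ≡ 0
at-out {N} f ℓ np with ℓ <? N
... | yes q = ⊥-elim (np q)
... | no _ = refl

at-fin : ∀ {N} (f : Fin N → ℕ) (i : Fin N) → at f (toℕ i) ≡ f i
at-fin f i = trans (at-lt f (toℕ i) (FP.toℕ<n i)) (cong f (FP.fromℕ<-toℕ i (FP.toℕ<n i)))

module Concrete {S N : ℕ} (D : ℕ → Diagram S N) (step : (k : ℕ) → D k →R D (suc k)) where

  Hk Ik Ok : ℕ → ℕ → ℕ
  Hk k = at (H (D k))
  Ik k = at (I (D k))
  Ok k = at (O (D k))

  nF mF : ℕ → Fin N
  nF k = proj₁ (step k)
  mF k = proj₁ (proj₂ (step k))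

  xh : ℕ → ℕ
  xh k = toℕ (nF k)

  exchangeAt : ∀ k → RightExchangeAt (D k) (D (suc k)) (nF k) (mF k)
  exchangeAt k = proj₂ (proj₂ (step k))

  at-m : ∀ k (f : Fin N → ℕ) → at f (suc (xh k)) ≡ f (mF k)
  at-m k f = trans (cong (at f) (sym (proj₁ (exchangeAt k)))) (at-fin f (mF k))

  at-rest : ∀ k (f f' : Fin N → ℕ) → ((j : Fin N) → j ≢ nF k → j ≢ mF k → f' j ≡ f j) →
            ∀ ℓ → ℓ ≢ xh k → ℓ ≢ suc (xh k) → at f' ℓ ≡ at f ℓ
  at-rest k f f' h ℓ p q = by-range (ℓ <? N)
    where
      by-range : Dec (ℓ < N) → at f' ℓ ≡ at f ℓ
      by-range (no np) = trans (at-out f' ℓ np) (sym (at-out f ℓ np))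
      by-range (yes lt) = trans (at-lt f' ℓ lt) (trans (h (fromℕ< lt) ≢n ≢m) (sym (at-lt f ℓ lt)))
        where
          ≢n : fromℕ< lt ≢ nF k
          ≢n eq = p (trans (sym (FP.toℕ-fromℕ< lt)) (cong toℕ eq))
          ≢m : fromℕ< lt ≢ mF k
          ≢m eq = q (trans (sym (FP.toℕ-fromℕ< lt)) (trans (cong toℕ eq) (proj₁ (exchangeAt k))))

  exchange : ∀ k → ExchangeStep N Hk Ik Ok xh k
  exchange k =
    let (m≡ , adm , hn , in′ , on , hm , im , om , rest) = exchangeAt k
        Dk = D k ; Dk′ = D (suc k) ; n = nF k
    in record
    { in-range   = subst (_< N) m≡ (FP.toℕ<n (mF k))
    ; admissible = subst₂ _≤_ (sym (cong₂ _+_ (at-fin (H Dk) n) (at-fin (O Dk) n))) (sym (at-m k (H Dk))) adm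
    ; H-top      = trans (at-fin (H Dk′) n) (trans hn (sym (cong₂ _+_ (cong₂ _∸_ (at-m k (H Dk)) (at-fin (O Dk) n)) (at-fin (I Dk) n))))
    ; I-top      = trans (at-fin (I Dk′) n) (trans in′ (sym (at-m k (I Dk))))
    ; O-top      = trans (at-fin (O Dk′) n) (trans on (sym (at-m k (O Dk))))
    ; H-bot      = trans (at-m k (H Dk′)) (trans hm (sym (at-fin (H Dk) n)))
    ; I-bot      = trans (at-m k (I Dk′)) (trans im (sym (at-fin (I Dk) n)))
    ; O-bot      = trans (at-m k (O Dk′)) (trans om (sym (at-fin (O Dk) n)))
    ; H-rest     = at-rest k (H Dk) (H Dk′) (λ j p q → proj₁ (rest j p q))
    ; I-rest     = at-rest k (I Dk) (I Dk′) (λ j p q → proj₁ (proj₂ (rest j p q)))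
    ; O-rest     = at-rest k (O Dk) (O Dk′) (λ j p q → proj₂ (proj₂ (rest j p q)))
    }

  open ExchangeSequence N Hk Ik Ok xh exchange public

  D₀ = D zero

  wire-step : ∀ {s p t q} → WireStep D₀ (s , p) (t , q) → (t ≡ suc s) × Passes 0 s p × (below 0 s p ≡ q)
  wire-step (pass-left i k lt) = refl , inj₁ lt′ , past-left (Hk 0 (toℕ i)) (Ik 0 (toℕ i)) (Ok 0 (toℕ i)) lt′
    where lt′ = subst (k <_) (sym (at-fin (H D₀) i)) lt
  wire-step (pass-right i k le) =
      refl , inj₂ le′
    , trans (past-right (Hk 0 (toℕ i)) (Ik 0 (toℕ i)) (Ok 0 (toℕ i)) (≤-trans (m≤m+n _ _) le′))
            (cong₂ (λ x y → k ∸ x + y) (at-fin (I D₀) i) (at-fin (O D₀) i))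
    where le′ = subst (_≤ k) (sym (cong₂ _+_ (at-fin (H D₀) i) (at-fin (I D₀) i))) le

  track-shift : ∀ s p ℓ → suc s ≤ ℓ → track 0 s p ℓ ≡ track 0 (suc s) (below 0 s p) ℓ
  track-shift s p ℓ le = sym (track-agree 0 0 s (suc s) p (below 0 s p) (suc s) ℓ (n≤1+n s) ≤-refl le
                           (trans (track-start 0 (suc s) _) (sym (trans (track-suc 0 s p s ≤-refl) (cong (below 0 s) (track-start 0 s p)))))
                           (λ _ _ _ _ → refl))

  ChainFacts : ℕ × ℕ → ℕ × ℕ → Set
  ChainFacts (s , p) (t , q) = (s ≤ t) × (track 0 s p t ≡ q) × (∀ ℓ → s ≤ ℓ → ℓ < t → Passes 0 ℓ (track 0 s p ℓ))

  wire-chain : ∀ {x y} → Star (WireStep D₀) x y → ChainFacts x y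
  wire-chain {s , p} ε = ≤-refl , track-start 0 s p , (λ ℓ sℓ ℓs → ⊥-elim (<-irrefl refl (<-≤-trans ℓs sℓ)))
  wire-chain {s , p} {t , q} (st ◅ rest) with wire-step st | wire-chain rest
  ... | refl , misses , moves | le , eq , ps = ≤-trans (n≤1+n s) le , trans (shifted t le) eq , passes
    where
      shifted : ∀ ℓ → suc s ≤ ℓ → track 0 s p ℓ ≡ track 0 (suc s) _ ℓ
      shifted ℓ l = trans (track-shift s p ℓ l) (cong (λ z → track 0 (suc s) z ℓ) moves)
      passes : ∀ ℓ → s ≤ ℓ → ℓ < t → Passes 0 ℓ (track 0 s p ℓ)
      passes ℓ sℓ ℓt with m≤n⇒m<n∨m≡n sℓ
      ... | inj₁ lt rewrite shifted ℓ lt = ps ℓ lt ℓt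
      ... | inj₂ refl rewrite track-start 0 s p = misses

  realise-edge : ∀ {a b} → EdgeBetween D₀ a b → Realisation a b
  realise-edge {a} {b} (j , q , l1 , l2 , st , m1 , m2) = record { edgeOf = e ; src≡ = refl ; tgt≡ = refl ; inv₀ = inv }
    where
      e = edge a b (j ∸ H D₀ a)
      chain = wire-chain st
      start : Hk 0 (toℕ a) + (j ∸ H D₀ a) ≡ j
      start = trans (cong (_+ (j ∸ H D₀ a)) (at-fin (H D₀) a)) (m+[n∸m]≡n l1)
      wire≡ : ∀ ℓ → wire 0 e ℓ ≡ track 0 (suc (toℕ a)) j ℓ
      wire≡ ℓ = cong (λ z → track 0 (suc (toℕ a)) z ℓ) start
      enters-b : Enters 0 (toℕ b) q
      enters-b = subst (_≤ q) (sym (at-fin (H D₀) b)) m1 , subst (q <_) (sym (cong₂ _+_ (at-fin (H D₀) b) (at-fin (I D₀) b))) m2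
      is-output : j ∸ H D₀ a < Ok 0 (toℕ a)
      is-output = subst (j ∸ H D₀ a <_) (sym (at-fin (O D₀) a))
                    (+-cancelˡ-< (H D₀ a) (j ∸ H D₀ a) (O D₀ a) (subst (_< H D₀ a + O D₀ a) (sym (m+[n∸m]≡n l1)) l2))
      inv : EdgeInv 0 e
      inv = record
        { downward = proj₁ chain
        ; port<O   = is-output
        ; passes   = λ ℓ l u → subst (Passes 0 ℓ) (sym (wire≡ ℓ)) (proj₂ (proj₂ chain) ℓ l u)
        ; enters   = subst (Enters 0 (toℕ b)) (sym (trans (wire≡ (toℕ b)) (proj₁ (proj₂ chain)))) enters-b
        }

-- The theorem: with connectivity of D₀, the counting argument applies to the
-- edges of D₀.
theorem30 : {S N : ℕ} (D : ℕ → Diagram S N) → Valid (D zero) → Connected (D zero) →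
    ¬ ((k : ℕ) → D k →R D (suc k))
theorem30 D _ connected step = Counting.absurd (EdgeBetween D₀) realise-edge connected
  where open Concrete D step
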